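{- Let $R=(r_1,\ldots,r_m)$, $C=(c_1,\ldots,c_n)$ be vectors of positive integers with $\sum_ir_i=\sum_jc_j$, $0<r_i<n$, $0<c_j<m$, and let $W=(w_{ij})$ be a real $m\times n$ matrix. Construct an $mn\times mn$ matrix $A=A(R,C;W)$ as follows. The rows of $A$ are partitioned into $m$ blocks of type I, the $i$-th having $n-r_i$ rows ($i=1,\ldots,m$), and $n$ blocks of type II, the $j$-th having $c_j$ rows ($j=1,\ldots,n$). The columns of $A$ are partitioned into $m$ blocks of $n$ columns each. For each $i$, every entry of $A$ in a row of the $i$-th type I block and in a column of the $i$-th column block equals $1$. For each $i,j$, every entry of $A$ in a row of the $j$-th type II block and in the $j$-th column of the $i$-th column block equals $w_{ij}$. All other entries of $A$ are $0$. Then $$|\Sigma(R,C;W)|=\Big(\prod_{i=1}^m\frac1{(n-r_i)!}\Big)\Big(\prod_{j=1}^n\frac1{c_j!}\Big)\operatorname{per}A,$$ where $|\Sigma(R,C;W)|=\sum_{D}\prod_{(i,j):d_{ij}=1}w_{ij}$, the sum over all $m\times n$ 0-1 matrices $D=(d_{ij})$ with row sums $R$ and column sums $C$.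
   Context: The permanent of an $N\times N$ matrix $A=(a_{ij})$ is $\operatorname{per}A=\sum_{\sigma\in S_N}\prod_{i=1}^N a_{i\sigma(i)}$. -}

module Defs where

open import Level using (Level)
open import Data.Nat as ℕ using (ℕ; zero; suc; _∸_; _≡ᵇ_; _!)
open import Data.Bool using (Bool; true; false; if_then_else_; _∧_; _∨_; not)
open import Data.Fin as Fin using (Fin; remQuot)
open import Data.Fin.Properties using () renaming (_≟_ to _≟ᶠ_)
open import Data.List using (List; []; _∷_; map; concatMap; foldr; replicate; _++_; allFin)
open import Data.Bool.ListAction using (and)
open import Data.Product using (_×_; _,_)
open import Data.Maybe using (Maybe; just; nothing)
open import Relation.Nullary.Decidable using (⌊_⌋)
open import Algebra.Bundles using (CommutativeRing)

allFuns : ∀ {a} {A : Set a} (k : ℕ) → List A → List (Fin k → A)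
allFuns zero    xs = (λ ()) ∷ []
allFuns (suc k) xs =
  concatMap (λ x → map (λ f → λ { Fin.zero → x ; (Fin.suc i) → f i }) (allFuns k xs)) xs

sumℕ : (k : ℕ) → (Fin k → ℕ) → ℕ
sumℕ k f = foldr ℕ._+_ 0 (map f (allFin k))

prodℕ : (k : ℕ) → (Fin k → ℕ) → ℕ
prodℕ k f = foldr ℕ._*_ 1 (map f (allFin k))

isInjB : (N : ℕ) → (Fin N → Fin N) → Bool
isInjB N f = and (concatMap (λ i → map (λ j → ⌊ i ≟ᶠ j ⌋ ∨ not ⌊ f i ≟ᶠ f j ⌋) (allFin N)) (allFin N))

data RowLabel (m n : ℕ) : Set where
  typeI  : Fin m → RowLabel m n
  typeII : Fin n → RowLabel m n

lookupMaybe : ∀ {a} {A : Set a} → List A → ℕ → Maybe A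
lookupMaybe []       _       = nothing
lookupMaybe (x ∷ xs) zero    = just x
lookupMaybe (x ∷ xs) (suc k) = lookupMaybe xs k

module _ {c ℓ} (𝓡 : CommutativeRing c ℓ) where
  open CommutativeRing 𝓡

  sumR : ∀ {a} {A : Set a} → List A → (A → Carrier) → Carrier
  sumR xs f = foldr _+_ 0# (map f xs)

  prodR : ∀ {a} {A : Set a} → List A → (A → Carrier) → Carrier
  prodR xs f = foldr _*_ 1# (map f xs)

  fromℕ : ℕ → Carrier
  fromℕ zero    = 0#
  fromℕ (suc k) = 1# + fromℕ k

  per : (N : ℕ) → (Fin N → Fin N → Carrier) → Carrier
  per N A = sumR (allFuns N (allFin N))
    (λ σ → if isInjB N σ then prodR (allFin N) (λ i → A i (σ i)) else 0#)

  module _ (m n : ℕ) (R : Fin m → ℕ) (C : Fin n → ℕ) (W : Fin m → Fin n → Carrier) where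

    bit : Bool → ℕ
    bit true  = 1
    bit false = 0

    marginsOK : (Fin m → Fin n → Bool) → Bool
    marginsOK D =
      and (map (λ i → sumℕ n (λ j → bit (D i j)) ≡ᵇ R i) (allFin m)) ∧
      and (map (λ j → sumℕ m (λ i → bit (D i j)) ≡ᵇ C j) (allFin n))

    weightD : (Fin m → Fin n → Bool) → Carrier
    weightD D = prodR (allFin m) (λ i → prodR (allFin n) (λ j →
                  if D i j then W i j else 1#))

    SigmaSize : Carrier
    SigmaSize = sumR (allFuns m (allFuns n (true ∷ false ∷ [])))
      (λ D → if marginsOK D then weightD D else 0#)

    rowLabels : List (RowLabel m n)
    rowLabels = concatMap (λ i → replicate (n ∸ R i) (typeI i)) (allFin m)
             ++ concatMap (λ j → replicate (C j) (typeII j)) (allFin n)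

    entry : RowLabel m n → Fin m → Fin n → Carrier
    entry (typeI i)  i' j' = if ⌊ i ≟ᶠ i' ⌋ then 1# else 0#
    entry (typeII j) i' j' = if ⌊ j ≟ᶠ j' ⌋ then W i' j' else 0#

    -- The mn × mn matrix A(R,C;W); column index k ∈ Fin (m*n) corresponds to
    -- (i', j') = remQuot n k, i.e. k = i'·n + j'.  Under the hypotheses the
    -- number of row labels is exactly m*n, so the 'nothing' case never occurs.
    matA : Fin (m ℕ.* n) → Fin (m ℕ.* n) → Carrier
    matA r k with lookupMaybe rowLabels (Fin.toℕ r) | remQuot {m} n k
    ... | just ℓb  | (i' , j') = entry ℓb i' j'
    ... | nothing  | _         = 0#

-- Expand per A row by row.  A column of A is a cell (i, j) of an m × n grid, and each row picks a
-- cell not used before.  The n − rᵢ type I rows of block i pick cells in grid row i (entry 1), the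
-- cⱼ type II rows of block j pick cells in grid column j (entry wᵢⱼ).  Identical rows may pick
-- their cells in any order, so each block contributes the factorial of its size times a sum over
-- subsets.  Since Σ (n − rᵢ) + Σ cⱼ = mn every cell gets used: the complement D of the type I
-- cells has row sums R, and the type II cells, cⱼ of them inside column j of D, are then forced
-- to be all of D, which therefore has column sums C and contributes ∏_{dᵢⱼ = 1} wᵢⱼ.

module Submission where

open import Data.Nat as ℕ using (ℕ; zero; suc; _∸_; _≤_; _<_; _!; _≡ᵇ_; z≤n; s≤s)
import Data.Nat.Properties as ℕP
open import Data.Bool using (Bool; true; false; if_then_else_; _∧_; _∨_; not; T)
open import Data.Bool.Properties using (∧-zeroʳ; ∧-identityʳ)
open import Data.Bool.ListAction using (and)
open import Data.Fin using (Fin; zero; suc; toℕ; combine; remQuot; _↑ˡ_; _↑ʳ_)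
open import Data.Fin.Properties using (any?; remQuot-combine; combine-injective; suc-injective)
  renaming (_≟_ to _≟ᶠ_)
open import Data.List using (List; []; _∷_; map; concatMap; foldr; _++_; allFin; tabulate; replicate; length)
open import Data.List.Properties using (map-tabulate; map-∘; map-cong; length-++; length-replicate)
open import Data.Vec.Functional using () renaming (_∷_ to _◂_)
open import Data.Product using (_×_; _,_; proj₁; proj₂)
open import Data.Maybe using (Maybe; just; nothing)
open import Data.Empty using (⊥-elim)
open import Relation.Nullary using (yes; no; ¬_; contradiction)
open import Relation.Nullary.Decidable using (⌊_⌋; does; dec-true)
open import Relation.Binary.PropositionalEquality as P using (_≡_; _≢_; _≗_)
open import Algebra.Bundles using (CommutativeMonoid; CommutativeRing)
open import Function using (id)
open import Function.Definitions using (Injective)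
open import Relation.Binary.Core using (_Preserves_⟶_)
open import Data.Vec.Functional.Relation.Binary.Pointwise using (Pointwise)
open import Defs

map-allFin-suc : ∀ {a} {A : Set a} {k} (f : Fin (suc k) → A) →
  map f (allFin (suc k)) ≡ f zero ∷ map (λ i → f (suc i)) (allFin k)
map-allFin-suc f = P.cong (f zero ∷_)
  (P.trans (map-tabulate suc f) (P.sym (map-tabulate id (λ i → f (suc i)))))

module BigOp {c ℓ} (M : CommutativeMonoid c ℓ) where
  open CommutativeMonoid M renaming (Carrier to X)
  open import Algebra.Properties.CommutativeSemigroup commutativeSemigroup using (interchange; x∙yz≈y∙xz)
  open import Relation.Binary.Reasoning.Setoid setoid

  ⨀ : ∀ {a} {A : Set a} → List A → (A → X) → X
  ⨀ xs f = foldr _∙_ ε (map f xs)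

  module _ {a} {A : Set a} where
    ⨀-cong : (xs : List A) {f g : A → X} → (∀ x → f x ≈ g x) → ⨀ xs f ≈ ⨀ xs g
    ⨀-cong []       e = refl
    ⨀-cong (x ∷ xs) e = ∙-cong (e x) (⨀-cong xs e)

    ⨀-++ : (xs ys : List A) (f : A → X) → ⨀ (xs ++ ys) f ≈ ⨀ xs f ∙ ⨀ ys f
    ⨀-++ []       ys f = sym (identityˡ _)
    ⨀-++ (x ∷ xs) ys f = trans (∙-congˡ (⨀-++ xs ys f)) (sym (assoc _ _ _))

    ⨀-ε : (xs : List A) → ⨀ xs (λ _ → ε) ≈ ε
    ⨀-ε []       = refl
    ⨀-ε (x ∷ xs) = trans (identityˡ _) (⨀-ε xs)

    ⨀-∙ : (xs : List A) (f g : A → X) → ⨀ xs (λ x → f x ∙ g x) ≈ ⨀ xs f ∙ ⨀ xs g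
    ⨀-∙ []       f g = sym (identityˡ _)
    ⨀-∙ (x ∷ xs) f g = trans (∙-congˡ (⨀-∙ xs f g)) (interchange _ _ _ _)

  ⨀-map : ∀ {a b} {A : Set a} {B : Set b} (g : A → B) (xs : List A) (f : B → X) →
    ⨀ (map g xs) f ≡ ⨀ xs (λ x → f (g x))
  ⨀-map g xs f = P.cong (foldr _∙_ ε) (P.sym (map-∘ xs))

  ⨀-concatMap : ∀ {a b} {A : Set a} {B : Set b} (g : A → List B) (xs : List A) (f : B → X) →
    ⨀ (concatMap g xs) f ≈ ⨀ xs (λ x → ⨀ (g x) f)
  ⨀-concatMap g []       f = refl
  ⨀-concatMap g (x ∷ xs) f = trans (⨀-++ (g x) _ f) (∙-congˡ (⨀-concatMap g xs f))

  ⨀-comm : ∀ {a b} {A : Set a} {B : Set b} (xs : List A) (ys : List B) (f : A → B → X) →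
    ⨀ xs (λ x → ⨀ ys (f x)) ≈ ⨀ ys (λ y → ⨀ xs (λ x → f x y))
  ⨀-comm []       ys f = sym (⨀-ε ys)
  ⨀-comm (x ∷ xs) ys f = trans (∙-congˡ (⨀-comm xs ys f)) (sym (⨀-∙ ys (f x) _))

  ⨀-allFin-suc : ∀ {k} (f : Fin (suc k) → X) →
    ⨀ (allFin (suc k)) f ≡ f zero ∙ ⨀ (allFin k) (λ i → f (suc i))
  ⨀-allFin-suc f = P.cong (foldr _∙_ ε) (map-allFin-suc f)

  ⨀-allFin-+ : ∀ a b (f : Fin (a ℕ.+ b) → X) →
    ⨀ (allFin (a ℕ.+ b)) f ≈ ⨀ (allFin a) (λ i → f (i ↑ˡ b)) ∙ ⨀ (allFin b) (λ j → f (a ↑ʳ j))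
  ⨀-allFin-+ zero    b f = sym (identityˡ _)
  ⨀-allFin-+ (suc a) b f = begin
    ⨀ (allFin (suc a ℕ.+ b)) f
      ≡⟨ ⨀-allFin-suc f ⟩
    f zero ∙ ⨀ (allFin (a ℕ.+ b)) (λ i → f (suc i))
      ≈⟨ ∙-congˡ (⨀-allFin-+ a b (λ i → f (suc i))) ⟩
    f zero ∙ (⨀ (allFin a) (λ i → f (suc (i ↑ˡ b))) ∙ rest)
      ≈⟨ sym (assoc _ _ _) ⟩
    (f zero ∙ ⨀ (allFin a) (λ i → f (suc (i ↑ˡ b)))) ∙ rest
      ≡⟨ P.cong (_∙ rest) (P.sym (⨀-allFin-suc (λ i → f (i ↑ˡ b)))) ⟩
    ⨀ (allFin (suc a)) (λ i → f (i ↑ˡ b)) ∙ rest ∎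
    where rest = ⨀ (allFin b) (λ j → f (suc a ↑ʳ j))

  ⨀-allFin-single : ∀ {k} (f : Fin k → X) (i₀ : Fin k) → (∀ i → i ≢ i₀ → f i ≈ ε) →
    ⨀ (allFin k) f ≈ f i₀
  ⨀-allFin-single {suc k} f zero h = begin
    ⨀ (allFin (suc k)) f                       ≡⟨ ⨀-allFin-suc f ⟩
    f zero ∙ ⨀ (allFin k) (λ i → f (suc i))    ≈⟨ ∙-congˡ (⨀-cong (allFin k) (λ i → h (suc i) (λ ()))) ⟩
    f zero ∙ ⨀ (allFin k) (λ _ → ε)            ≈⟨ ∙-congˡ (⨀-ε (allFin k)) ⟩
    f zero ∙ ε                                 ≈⟨ identityʳ _ ⟩
    f zero                                     ∎
  ⨀-allFin-single {suc k} f (suc i₀) h = begin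
    ⨀ (allFin (suc k)) f                       ≡⟨ ⨀-allFin-suc f ⟩
    f zero ∙ ⨀ (allFin k) (λ i → f (suc i))    ≈⟨ ∙-cong (h zero (λ ())) (⨀-allFin-single (λ i → f (suc i)) i₀ h') ⟩
    ε ∙ f (suc i₀)                             ≈⟨ identityˡ _ ⟩
    f (suc i₀)                                 ∎
    where h' = λ i i≢i₀ → h (suc i) (λ e → i≢i₀ (suc-injective e))

  ⨀-allFin-extract : ∀ {k} (f : Fin k → X) (x : Fin k) →
    ⨀ (allFin k) f ≈ f x ∙ ⨀ (allFin k) (λ y → if does (y ≟ᶠ x) then ε else f y)
  ⨀-allFin-extract {suc k} f zero = begin
    ⨀ (allFin (suc k)) f                           ≡⟨ ⨀-allFin-suc f ⟩
    f zero ∙ ⨀ (allFin k) (λ i → f (suc i))        ≈⟨ ∙-congˡ (sym (identityˡ _)) ⟩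
    f zero ∙ (ε ∙ ⨀ (allFin k) (λ i → f (suc i)))  ≡⟨ P.cong (f zero ∙_) (P.sym (⨀-allFin-suc (dropAt zero))) ⟩
    f zero ∙ ⨀ (allFin (suc k)) (dropAt zero)      ∎
    where dropAt = λ x y → if does (y ≟ᶠ x) then ε else f y
  ⨀-allFin-extract {suc k} f (suc x) = begin
    ⨀ (allFin (suc k)) f                       ≡⟨ ⨀-allFin-suc f ⟩
    f zero ∙ ⨀ (allFin k) (λ i → f (suc i))    ≈⟨ ∙-congˡ (⨀-allFin-extract (λ i → f (suc i)) x) ⟩
    f zero ∙ (f (suc x) ∙ rest)                ≈⟨ x∙yz≈y∙xz _ _ _ ⟩
    f (suc x) ∙ (f zero ∙ rest)                ≡⟨ P.cong (f (suc x) ∙_) (P.sym (⨀-allFin-suc {k = k} _)) ⟩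
    f (suc x) ∙ ⨀ (allFin (suc k)) (λ y → if does (y ≟ᶠ suc x) then ε else f y) ∎
    where rest = ⨀ (allFin k) (λ y → if does (y ≟ᶠ x) then ε else f (suc y))

∧≡true⁻ : ∀ {a b} → (a ∧ b) ≡ true → a ≡ true × b ≡ true
∧≡true⁻ {true} {true} _ = P.refl , P.refl

∧≡true⁺ : ∀ {a b} → a ≡ true → b ≡ true → (a ∧ b) ≡ true
∧≡true⁺ P.refl P.refl = P.refl

∨-reassoc : ∀ a b c → (b ∨ (a ∨ c)) ≡ ((a ∨ b) ∨ c)
∨-reassoc true  true  c = P.refl
∨-reassoc true  false c = P.refl
∨-reassoc false b     c = P.refl

and-++ : (xs ys : List Bool) → and (xs ++ ys) ≡ (and xs ∧ and ys)
and-++ []           ys = P.refl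
and-++ (true ∷ xs)  ys = and-++ xs ys
and-++ (false ∷ xs) ys = P.refl

and-concatMap : ∀ {a} {A : Set a} (h : A → List Bool) (xs : List A) →
  and (concatMap h xs) ≡ and (map (λ x → and (h x)) xs)
and-concatMap h []       = P.refl
and-concatMap h (x ∷ xs) = P.trans (and-++ (h x) _) (P.cong (and (h x) ∧_) (and-concatMap h xs))

and-const-true : ∀ {a} {A : Set a} (xs : List A) → and (map (λ _ → true) xs) ≡ true
and-const-true []       = P.refl
and-const-true (x ∷ xs) = and-const-true xs

and-allFin⁻ : ∀ {k} (f : Fin k → Bool) → and (map f (allFin k)) ≡ true → ∀ i → f i ≡ true
and-allFin⁻ {suc k} f e i with ∧≡true⁻ {f zero} (P.subst (λ l → and l ≡ true) (map-allFin-suc f) e) | i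
... | f0 , _  | zero  = f0
... | _  , fs | suc i = and-allFin⁻ (λ i → f (suc i)) fs i

and-allFin⁺ : ∀ {k} (f : Fin k → Bool) → (∀ i → f i ≡ true) → and (map f (allFin k)) ≡ true
and-allFin⁺ {zero}  f h = P.refl
and-allFin⁺ {suc k} f h = P.subst (λ l → and l ≡ true) (P.sym (map-allFin-suc f))
  (∧≡true⁺ (h zero) (and-allFin⁺ (λ i → f (suc i)) (λ i → h (suc i))))

isInjectiveᵇ : (k N : ℕ) → (Fin k → Fin N) → Bool
isInjectiveᵇ k N f =
  and (concatMap (λ i → map (λ j → ⌊ i ≟ᶠ j ⌋ ∨ not ⌊ f i ≟ᶠ f j ⌋) (allFin k)) (allFin k))

module _ {k N : ℕ} (f : Fin k → Fin N) where

  private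
    pairTest : Fin k → Fin k → Bool
    pairTest i j = ⌊ i ≟ᶠ j ⌋ ∨ not ⌊ f i ≟ᶠ f j ⌋

    isInjectiveᵇ-pairs : isInjectiveᵇ k N f ≡ and (map (λ i → and (map (pairTest i) (allFin k))) (allFin k))
    isInjectiveᵇ-pairs = and-concatMap _ (allFin k)

    pairTest-sound : ∀ i j → pairTest i j ≡ true → f i ≡ f j → i ≡ j
    pairTest-sound i j t fi≡fj with i ≟ᶠ j | f i ≟ᶠ f j
    ... | yes i≡j | _        = i≡j
    ... | no _    | no fi≢fj = ⊥-elim (fi≢fj fi≡fj)

    pairTest-complete : ∀ i j → (f i ≡ f j → i ≡ j) → pairTest i j ≡ true
    pairTest-complete i j h with i ≟ᶠ j | f i ≟ᶠ f j
    ... | yes _   | _       = P.refl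
    ... | no i≢j  | yes fe  = ⊥-elim (i≢j (h fe))
    ... | no _    | no _    = P.refl

  isInjectiveᵇ-sound : isInjectiveᵇ k N f ≡ true → Injective _≡_ _≡_ f
  isInjectiveᵇ-sound t {i} {j} = pairTest-sound i j
    (and-allFin⁻ _ (and-allFin⁻ _ (P.trans (P.sym isInjectiveᵇ-pairs) t) i) j)

  isInjectiveᵇ-complete : Injective _≡_ _≡_ f → isInjectiveᵇ k N f ≡ true
  isInjectiveᵇ-complete inj = P.trans isInjectiveᵇ-pairs
    (and-allFin⁺ _ (λ i → and-allFin⁺ _ (λ j → pairTest-complete i j inj)))


boolToℕ : Bool → ℕ
boolToℕ true  = 1
boolToℕ false = 0

module ℕSum = BigOp ℕP.+-0-commutativeMonoid

sumℕ-suc : ∀ k (a : Fin (suc k) → ℕ) → sumℕ (suc k) a ≡ a zero ℕ.+ sumℕ k (λ j → a (suc j))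
sumℕ-suc k a = ℕSum.⨀-allFin-suc a

sumℕ-mono : ∀ k (a b : Fin k → ℕ) → (∀ j → a j ≤ b j) → sumℕ k a ≤ sumℕ k b
sumℕ-mono zero    a b h = z≤n
sumℕ-mono (suc k) a b h rewrite sumℕ-suc k a | sumℕ-suc k b =
  ℕP.+-mono-≤ (h zero) (sumℕ-mono k _ _ (λ j → h (suc j)))

sumℕ-mono-≡ : ∀ k (a b : Fin k → ℕ) → (∀ j → a j ≤ b j) → sumℕ k a ≡ sumℕ k b → ∀ j → a j ≡ b j
sumℕ-mono-≡ (suc k) a b a≤b sums≡ = λ where
    zero    → a₀≡b₀
    (suc j) → sumℕ-mono-≡ k _ _ (λ j → a≤b (suc j))
                (ℕP.+-cancelˡ-≡ (a zero) _ _ (P.trans split (P.cong (ℕ._+ _) (P.sym a₀≡b₀)))) j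
  where
  split : a zero ℕ.+ sumℕ k (λ j → a (suc j)) ≡ b zero ℕ.+ sumℕ k (λ j → b (suc j))
  split = P.trans (P.sym (sumℕ-suc k a)) (P.trans sums≡ (sumℕ-suc k b))
  b₀≤a₀ : b zero ≤ a zero
  b₀≤a₀ = ℕP.+-cancelʳ-≤ (sumℕ k (λ j → b (suc j))) (b zero) (a zero)
    (ℕP.≤-trans (ℕP.≤-reflexive (P.sym split))
                (ℕP.+-monoʳ-≤ (a zero) (sumℕ-mono k _ _ (λ j → a≤b (suc j)))))
  a₀≡b₀ : a zero ≡ b zero
  a₀≡b₀ = ℕP.≤-antisym (a≤b zero) b₀≤a₀

sumℕ-const : ∀ m n → sumℕ m (λ _ → n) ≡ m ℕ.* n
sumℕ-const zero    n = P.refl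
sumℕ-const (suc m) n = P.trans (sumℕ-suc m (λ _ → n)) (P.cong (n ℕ.+_) (sumℕ-const m n))

length-concatMap-replicate : ∀ {a} {A : Set a} {k} (t : Fin k → ℕ) (g : Fin k → A) (xs : List (Fin k)) →
  length (concatMap (λ i → replicate (t i) (g i)) xs) ≡ foldr ℕ._+_ 0 (map t xs)
length-concatMap-replicate t g []       = P.refl
length-concatMap-replicate t g (x ∷ xs) = P.trans (length-++ (replicate (t x) (g x)))
  (P.cong₂ ℕ._+_ (length-replicate (t x)) (length-concatMap-replicate t g xs))

length-blocks : ∀ {a} {A : Set a} {m n} (R : Fin m → ℕ) (C : Fin n → ℕ) (f : Fin m → A) (g : Fin n → A) →
  sumℕ m R ≡ sumℕ n C → (∀ i → R i ≤ n) →
  length (concatMap (λ i → replicate (n ∸ R i) (f i)) (allFin m) ++ concatMap (λ j → replicate (C j) (g j)) (allFin n))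
    ≡ m ℕ.* n
length-blocks {m = m} {n} R C f g sums≡ R≤n = begin
  length (rowsI ++ rowsII)                  ≡⟨ length-++ rowsI ⟩
  length rowsI ℕ.+ length rowsII            ≡⟨ P.cong₂ ℕ._+_ (length-concatMap-replicate (λ i → n ∸ R i) f (allFin m))
                                                             (length-concatMap-replicate C g (allFin n)) ⟩
  sumℕ m (λ i → n ∸ R i) ℕ.+ sumℕ n C      ≡⟨ P.cong (sumℕ m (λ i → n ∸ R i) ℕ.+_) (P.sym sums≡) ⟩
  sumℕ m (λ i → n ∸ R i) ℕ.+ sumℕ m R      ≡⟨ P.sym (ℕSum.⨀-∙ (allFin m) (λ i → n ∸ R i) R) ⟩
  sumℕ m (λ i → n ∸ R i ℕ.+ R i)           ≡⟨ ℕSum.⨀-cong (allFin m) (λ i → ℕP.m∸n+n≡m (R≤n i)) ⟩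
  sumℕ m (λ _ → n)                          ≡⟨ sumℕ-const m n ⟩
  m ℕ.* n                                   ∎
  where
  open P.≡-Reasoning
  rowsI  = concatMap (λ i → replicate (n ∸ R i) (f i)) (allFin m)
  rowsII = concatMap (λ j → replicate (C j) (g j)) (allFin n)

≡ᵇ⇒≡ : ∀ {a b} → (a ≡ᵇ b) ≡ true → a ≡ b
≡ᵇ⇒≡ {a} {b} e = ℕP.≡ᵇ⇒≡ a b (P.subst T (P.sym e) _)

∸-≡ᵇ : ∀ n a b → a ≤ n → b ≤ n → (n ∸ a ≡ᵇ n ∸ b) ≡ (a ≡ᵇ b)
∸-≡ᵇ n a b a≤n b≤n with a ≡ᵇ b in a≟b | n ∸ a ≡ᵇ n ∸ b in n∸a≟n∸b
... | true  | true  = P.refl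
... | false | false = P.refl
... | true  | false = ⊥-elim (P.subst T n∸a≟n∸b (ℕP.≡⇒≡ᵇ (n ∸ a) (n ∸ b) (P.cong (n ∸_) (≡ᵇ⇒≡ {a} {b} a≟b))))
... | false | true  = ⊥-elim (P.subst T a≟b (ℕP.≡⇒≡ᵇ a b (P.trans (P.sym (ℕP.m∸[m∸n]≡n a≤n))
                        (P.trans (P.cong (n ∸_) (≡ᵇ⇒≡ {n ∸ a} {n ∸ b} n∸a≟n∸b)) (ℕP.m∸[m∸n]≡n b≤n)))))

Subset : ℕ → Set
Subset p = Fin p → Bool

∣_∣ : ∀ {p} → Subset p → ℕ
∣_∣ {p} S = sumℕ p (λ y → boolToℕ (S y))

insert : ∀ {p} → Subset p → Fin p → Subset p
insert s x y = does (y ≟ᶠ x) ∨ s y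

_∪_ : ∀ {p} → Subset p → Subset p → Subset p
(s ∪ S) y = S y ∨ s y

∁ : ∀ {p} → Subset p → Subset p
∁ S y = not (S y)

_⊆_ : ∀ {p} → Subset p → Subset p → Set
S ⊆ S' = ∀ y → S y ≡ true → S' y ≡ true

disjointᵇ : ∀ {p} → Subset p → Subset p → Bool
disjointᵇ {p} S s = and (map (λ y → not (S y ∧ s y)) (allFin p))

sizedDisjointᵇ : ∀ {p} → ℕ → Subset p → Subset p → Bool
sizedDisjointᵇ t s S = (∣ S ∣ ≡ᵇ t) ∧ disjointᵇ S s

∣∣-suc : ∀ {p} (S : Subset (suc p)) → ∣ S ∣ ≡ boolToℕ (S zero) ℕ.+ ∣ (λ y → S (suc y)) ∣
∣∣-suc S = ℕSum.⨀-allFin-suc (λ y → boolToℕ (S y))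

∣∣-cong : ∀ {p} {S S' : Subset p} → S ≗ S' → ∣ S ∣ ≡ ∣ S' ∣
∣∣-cong {p} e = ℕSum.⨀-cong (allFin p) (λ y → P.cong boolToℕ (e y))

∣∅∣ : ∀ {p} → ∣ (λ (_ : Fin p) → false) ∣ ≡ 0
∣∅∣ {p} = ℕSum.⨀-ε (allFin p)

∣S∣≡0⇒S≗∅ : ∀ {p} (S : Subset p) → ∣ S ∣ ≡ 0 → S ≗ (λ _ → false)
∣S∣≡0⇒S≗∅ {suc p} S e i with S zero in S₀ | P.trans (P.sym (∣∣-suc S)) e
∣S∣≡0⇒S≗∅ {suc p} S e zero    | false | _  = S₀
∣S∣≡0⇒S≗∅ {suc p} S e (suc i) | false | e' = ∣S∣≡0⇒S≗∅ (λ y → S (suc y)) e' i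

∣insert∣ : ∀ {p} (S : Subset p) x → S x ≡ false → ∣ insert S x ∣ ≡ suc ∣ S ∣
∣insert∣ {p} S x x∉S = begin
  ∣ insert S x ∣
    ≡⟨ ℕSum.⨀-allFin-extract (λ y → boolToℕ (insert S x y)) x ⟩
  boolToℕ (does (x ≟ᶠ x) ∨ S x) ℕ.+ rest (insert S x)
    ≡⟨ P.cong₂ ℕ._+_ (P.cong (λ b → boolToℕ (b ∨ S x)) (dec-true (x ≟ᶠ x) P.refl)) (ℕSum.⨀-cong (allFin p) away) ⟩
  suc (rest S)
    ≡⟨ P.cong (λ b → suc (boolToℕ b ℕ.+ rest S)) (P.sym x∉S) ⟩
  suc (boolToℕ (S x) ℕ.+ rest S)
    ≡⟨ P.cong suc (P.sym (ℕSum.⨀-allFin-extract (λ y → boolToℕ (S y)) x)) ⟩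
  suc ∣ S ∣ ∎
  where
  open P.≡-Reasoning
  rest : Subset p → ℕ
  rest T = ℕSum.⨀ (allFin p) (λ y → if does (y ≟ᶠ x) then 0 else boolToℕ (T y))
  away : ∀ y → (if does (y ≟ᶠ x) then 0 else boolToℕ (insert S x y)) ≡ (if does (y ≟ᶠ x) then 0 else boolToℕ (S y))
  away y with does (y ≟ᶠ x)
  ... | true  = P.refl
  ... | false = P.refl

∣S∣+∣∁S∣≡p : ∀ {p} (S : Subset p) → ∣ S ∣ ℕ.+ ∣ ∁ S ∣ ≡ p
∣S∣+∣∁S∣≡p {zero}  S = P.refl
∣S∣+∣∁S∣≡p {suc p} S rewrite ∣∣-suc S | ∣∣-suc (∁ S) with S zero
... | true  = P.cong suc (∣S∣+∣∁S∣≡p (λ y → S (suc y)))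
... | false = P.trans (ℕP.+-suc _ _) (P.cong suc (∣S∣+∣∁S∣≡p (λ y → S (suc y))))

∣∁S∣≡p∸∣S∣ : ∀ {p} (S : Subset p) → ∣ ∁ S ∣ ≡ p ∸ ∣ S ∣
∣∁S∣≡p∸∣S∣ S = P.trans (P.sym (ℕP.m+n∸m≡n ∣ S ∣ _)) (P.cong (_∸ ∣ S ∣) (∣S∣+∣∁S∣≡p S))

∣S∣≤p : ∀ {p} (S : Subset p) → ∣ S ∣ ≤ p
∣S∣≤p S = P.subst (∣ S ∣ ≤_) (∣S∣+∣∁S∣≡p S) (ℕP.m≤m+n _ _)

∣∣-mono-⊆ : ∀ {p} (S S' : Subset p) → S ⊆ S' → ∣ S ∣ ≤ ∣ S' ∣
∣∣-mono-⊆ {zero}  S S' h = z≤n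
∣∣-mono-⊆ {suc p} S S' h rewrite ∣∣-suc S | ∣∣-suc S' with S zero in S₀ | S' zero in S'₀
... | true  | true  = s≤s (∣∣-mono-⊆ _ _ (λ y → h (suc y)))
... | false | true  = ℕP.≤-trans (∣∣-mono-⊆ _ _ (λ y → h (suc y))) (ℕP.n≤1+n _)
... | false | false = ∣∣-mono-⊆ _ _ (λ y → h (suc y))
... | true  | false with () ← P.trans (P.sym S'₀) (h zero S₀)

⊆∧∣∣≡⇒≗ : ∀ {p} (S S' : Subset p) → S ⊆ S' → ∣ S ∣ ≡ ∣ S' ∣ → S ≗ S'
⊆∧∣∣≡⇒≗ {suc p} S S' h e = λ where
    zero    → proj₁ head-and-tail
    (suc y) → ⊆∧∣∣≡⇒≗ _ _ (λ y → h (suc y)) (proj₂ head-and-tail) y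
  where
  head-and-tail : S zero ≡ S' zero × ∣ (λ y → S (suc y)) ∣ ≡ ∣ (λ y → S' (suc y)) ∣
  head-and-tail with S zero in S₀ | S' zero in S'₀ | P.trans (P.sym (∣∣-suc S)) (P.trans e (∣∣-suc S'))
  ... | true  | true  | e' = P.refl , ℕP.suc-injective e'
  ... | false | false | e' = P.refl , e'
  ... | true  | false | _ with () ← P.trans (P.sym S'₀) (h zero S₀)
  ... | false | true  | e' = ⊥-elim (ℕP.<⇒≱ (ℕP.≤-reflexive (P.sym e')) (∣∣-mono-⊆ _ _ (λ y → h (suc y))))

disjointᵇ-cong : ∀ {p} {S S' s s' : Subset p} → S ≗ S' → s ≗ s' → disjointᵇ S s ≡ disjointᵇ S' s'
disjointᵇ-cong {p} e₁ e₂ = P.cong and (map-cong (λ y → P.cong₂ (λ a b → not (a ∧ b)) (e₁ y) (e₂ y)) (allFin p))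

disjointᵇ-false : ∀ {p} (S s : Subset p) x → S x ≡ true → s x ≡ true → disjointᵇ S s ≡ false
disjointᵇ-false {p} S s x x∈S x∈s with disjointᵇ S s in d
... | false = P.refl
... | true with () ← P.trans (P.sym (P.cong₂ (λ a b → not (a ∧ b)) x∈S x∈s)) (and-allFin⁻ _ d x)

disjointᵇ-insertʳ : ∀ {p} (S s : Subset p) x → S x ≡ false → disjointᵇ S (insert s x) ≡ disjointᵇ S s
disjointᵇ-insertʳ {p} S s x x∉S = P.cong and (map-cong pointwise (allFin p))
  where
  pointwise : ∀ y → not (S y ∧ insert s x y) ≡ not (S y ∧ s y)
  pointwise y with y ≟ᶠ x
  ... | yes P.refl rewrite x∉S = P.refl
  ... | no _ = P.refl

disjointᵇ-insertˡ : ∀ {p} (S s : Subset p) x → S x ≡ false → s x ≡ false → disjointᵇ (insert S x) s ≡ disjointᵇ S s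
disjointᵇ-insertˡ {p} S s x x∉S x∉s = P.cong and (map-cong pointwise (allFin p))
  where
  pointwise : ∀ y → not (insert S x y ∧ s y) ≡ not (S y ∧ s y)
  pointwise y with y ≟ᶠ x
  ... | yes P.refl rewrite x∉S | x∉s = P.refl
  ... | no _ = P.refl

disjointᵇ-∅ : ∀ {p} (S : Subset p) → disjointᵇ S (λ _ → false) ≡ true
disjointᵇ-∅ {p} S = P.trans (P.cong and (map-cong (λ y → P.cong not (∧-zeroʳ (S y))) (allFin p)))
  (and-const-true (allFin p))

disjointᵇ-∅∪∁ : ∀ {p} (S : Subset p) → disjointᵇ S ((λ _ → false) ∪ ∁ S) ≡ true
disjointᵇ-∅∪∁ {p} S = and-allFin⁺ _ (λ y → lemma (S y))
  where
  lemma : ∀ b → not (b ∧ (not b ∨ false)) ≡ true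
  lemma true  = P.refl
  lemma false = P.refl

disjointᵇ-∅∪∁⇒⊆ : ∀ {p} (T S : Subset p) → disjointᵇ T ((λ _ → false) ∪ ∁ S) ≡ true → T ⊆ S
disjointᵇ-∅∪∁⇒⊆ T S disjoint y y∈T = lemma (T y) (S y) (and-allFin⁻ _ disjoint y) y∈T
  where
  lemma : ∀ t s → not (t ∧ (not s ∨ false)) ≡ true → t ≡ true → s ≡ true
  lemma true true _ _ = P.refl

sizedDisjointᵇ-cong : ∀ {p} t {s s' S S' : Subset p} → s ≗ s' → S ≗ S' →
  sizedDisjointᵇ t s S ≡ sizedDisjointᵇ t s' S'
sizedDisjointᵇ-cong t es eS = P.cong₂ _∧_ (P.cong (_≡ᵇ t) (∣∣-cong eS)) (disjointᵇ-cong eS es)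

sizedDisjointᵇ-∁ : ∀ {p} r (S : Subset p) → r ≤ p → sizedDisjointᵇ (p ∸ r) (λ _ → false) (∁ S) ≡ (∣ S ∣ ≡ᵇ r)
sizedDisjointᵇ-∁ {p} r S r≤p = begin
  (∣ ∁ S ∣ ≡ᵇ p ∸ r) ∧ disjointᵇ (∁ S) (λ _ → false)
    ≡⟨ P.cong₂ _∧_ (P.cong (_≡ᵇ p ∸ r) (∣∁S∣≡p∸∣S∣ S)) (disjointᵇ-∅ (∁ S)) ⟩
  (p ∸ ∣ S ∣ ≡ᵇ p ∸ r) ∧ true   ≡⟨ ∧-identityʳ _ ⟩
  (p ∸ ∣ S ∣ ≡ᵇ p ∸ r)          ≡⟨ ∸-≡ᵇ p ∣ S ∣ r (∣S∣≤p S) r≤p ⟩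
  (∣ S ∣ ≡ᵇ r)                  ∎
  where open P.≡-Reasoning

Grid : ℕ → ℕ → Set
Grid q p = Fin q → Subset p

_≗₂_ : ∀ {q p} → Grid q p → Grid q p → Set
Z ≗₂ Z' = ∀ a → Z a ≗ Z' a

_∪₂_ : ∀ {q p} → Grid q p → Grid q p → Grid q p
(Z ∪₂ S) a = Z a ∪ S a

updateLine : ∀ {q p} → Grid q p → Fin q → Subset p → Grid q p
updateLine Z a s a' = if does (a' ≟ᶠ a) then s else Z a'

updateLine-cong : ∀ {q p} {Z Z' : Grid q p} a {s s'} → Z ≗₂ Z' → s ≗ s' → updateLine Z a s ≗₂ updateLine Z' a s'
updateLine-cong a Z≗Z' s≗s' a' with does (a' ≟ᶠ a)
... | true  = s≗s'
... | false = Z≗Z' a'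

transpose : ∀ {q p} → Grid q p → Grid p q
transpose K b a = K a b

updateColumn : ∀ {q p} → Grid q p → Fin p → Subset q → Grid q p
updateColumn K j T = transpose (updateLine (transpose K) j T)

sum∣∣-transpose : ∀ {q p} (D : Grid q p) → sumℕ q (λ i → ∣ D i ∣) ≡ sumℕ p (λ j → ∣ transpose D j ∣)
sum∣∣-transpose {q} {p} D = ℕSum.⨀-comm (allFin q) (allFin p) (λ i j → boolToℕ (D i j))

⊆-transpose-≗ : ∀ {q p} (D : Grid q p) (T : Grid p q) (C : Fin p → ℕ) → (∀ j → T j ⊆ transpose D j) →
  (∀ j → ∣ T j ∣ ≡ C j) → sumℕ q (λ i → ∣ D i ∣) ≡ sumℕ p C → T ≗₂ transpose D
⊆-transpose-≗ {q} {p} D T C T⊆D ∣T∣≡C sums j = ⊆∧∣∣≡⇒≗ (T j) (transpose D j) (T⊆D j) (sizes j)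
  where
  sizes : ∀ j → ∣ T j ∣ ≡ ∣ transpose D j ∣
  sizes = sumℕ-mono-≡ p _ _ (λ j → ∣∣-mono-⊆ _ _ (T⊆D j))
    (P.trans (ℕSum.⨀-cong (allFin p) ∣T∣≡C) (P.trans (P.sym sums) (sum∣∣-transpose D)))

≗⇒Pointwise : ∀ {a r k} {A : Set a} (_~_ : A → A → Set r) → (∀ x → x ~ x) →
  {F G : Fin k → A} → F ≗ G → Pointwise _~_ F G
≗⇒Pointwise _~_ ~-refl {F} F≗G i = P.subst (F i ~_) (F≗G i) (~-refl (F i))

module _ {c ℓ} (𝓡 : CommutativeRing c ℓ) where
  open CommutativeRing 𝓡 hiding (zero)
  open import Relation.Binary.Reasoning.Setoid setoid
  open import Algebra.Properties.CommutativeSemigroup *-commutativeSemigroup using (x∙yz≈y∙xz)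

  module Sum  = BigOp +-commutativeMonoid
  module Prod = BigOp *-commutativeMonoid

  ∑ : ∀ {a} {A : Set a} → List A → (A → Carrier) → Carrier
  ∑ = Sum.⨀

  ∏ : ∀ {a} {A : Set a} → List A → (A → Carrier) → Carrier
  ∏ = Prod.⨀

  ∑-*ˡ : ∀ {a} {A : Set a} (xs : List A) (x : Carrier) (f : A → Carrier) → ∑ xs (λ y → x * f y) ≈ x * ∑ xs f
  ∑-*ˡ []       x f = sym (zeroʳ x)
  ∑-*ˡ (y ∷ ys) x f = trans (+-congˡ (∑-*ˡ ys x f)) (sym (distribˡ _ _ _))

  ∏-zero : ∀ {k} (f : Fin k → Carrier) (i : Fin k) → f i ≈ 0# → ∏ (allFin k) f ≈ 0#
  ∏-zero {suc k} f i fi≈0 rewrite Prod.⨀-allFin-suc f with i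
  ... | zero  = trans (*-congʳ fi≈0) (zeroˡ _)
  ... | suc i = trans (*-congˡ (∏-zero (λ j → f (suc j)) i fi≈0)) (zeroʳ _)

  fromℕ-+ : ∀ a b → fromℕ 𝓡 (a ℕ.+ b) ≈ fromℕ 𝓡 a + fromℕ 𝓡 b
  fromℕ-+ zero    b = sym (+-identityˡ _)
  fromℕ-+ (suc a) b = trans (+-congˡ (fromℕ-+ a b)) (sym (+-assoc _ _ _))

  fromℕ-* : ∀ a b → fromℕ 𝓡 (a ℕ.* b) ≈ fromℕ 𝓡 a * fromℕ 𝓡 b
  fromℕ-* zero    b = sym (zeroˡ _)
  fromℕ-* (suc a) b = begin
    fromℕ 𝓡 (b ℕ.+ a ℕ.* b)                     ≈⟨ fromℕ-+ b (a ℕ.* b) ⟩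
    fromℕ 𝓡 b + fromℕ 𝓡 (a ℕ.* b)               ≈⟨ +-cong (sym (*-identityˡ _)) (fromℕ-* a b) ⟩
    1# * fromℕ 𝓡 b + fromℕ 𝓡 a * fromℕ 𝓡 b      ≈⟨ sym (distribʳ _ _ _) ⟩
    (1# + fromℕ 𝓡 a) * fromℕ 𝓡 b               ∎

  guard : Bool → Carrier → Carrier → Carrier
  guard b w h = (if b then w else 0#) * h

  guard-false : ∀ w h → guard false w h ≈ 0#
  guard-false w h = zeroˡ h

  guard-cong : ∀ {b b'} {w w' h h'} → b ≡ b' → w ≈ w' → h ≈ h' → guard b w h ≈ guard b' w' h'
  guard-cong {true}  P.refl ew eh = *-cong ew eh
  guard-cong {false} P.refl ew eh = *-congˡ eh

  guard-≡false : ∀ {b} w h → b ≡ false → guard b w h ≈ 0#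
  guard-≡false w h P.refl = guard-false w h

  guard-*ˡ : ∀ b a w h → a * guard b w h ≈ guard b (a * w) h
  guard-*ˡ true  a w h = sym (*-assoc _ _ _)
  guard-*ˡ false a w h = trans (*-congˡ (zeroˡ h)) (trans (zeroʳ a) (sym (zeroˡ h)))

  guard-*ʳ : ∀ b w x h → guard b w (x * h) ≈ x * guard b w h
  guard-*ʳ b w x h = x∙yz≈y∙xz _ _ _

  guard-∧ : ∀ b₁ b₂ w₁ w₂ h → guard (b₁ ∧ b₂) (w₁ * w₂) h ≈ guard b₁ w₁ (guard b₂ w₂ h)
  guard-∧ true  true  w₁ w₂ h = *-assoc _ _ _
  guard-∧ true  false w₁ w₂ h = trans (zeroˡ _) (sym (trans (*-congˡ (zeroˡ _)) (zeroʳ _)))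
  guard-∧ false b₂    w₁ w₂ h = trans (zeroˡ _) (sym (zeroˡ _))

  guard-∑ : ∀ {a} {A : Set a} b w (xs : List A) f → guard b w (∑ xs f) ≈ ∑ xs (λ x → guard b w (f x))
  guard-∑ b w xs f = sym (∑-*ˡ xs _ f)

  rectPerTerm : ∀ k N → (Fin k → Fin N → Carrier) → (Fin k → Fin N) → Carrier
  rectPerTerm k N A σ = if isInjectiveᵇ k N σ then ∏ (allFin k) (λ i → A i (σ i)) else 0#

  -- The permanent of a k × N matrix; for k = N it is Defs.per on the nose.
  rectPer : (k N : ℕ) → (Fin k → Fin N → Carrier) → Carrier
  rectPer k N A = ∑ (allFuns k (allFin N)) (rectPerTerm k N A)

  rectPer-cong : ∀ k N (A B : Fin k → Fin N → Carrier) → (∀ i y → A i y ≈ B i y) → rectPer k N A ≈ rectPer k N B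
  rectPer-cong k N A B e = Sum.⨀-cong (allFuns k (allFin N)) λ σ → termCong σ (isInjectiveᵇ k N σ)
    where
    termCong : ∀ σ b → (if b then ∏ (allFin k) (λ i → A i (σ i)) else 0#)
                     ≈ (if b then ∏ (allFin k) (λ i → B i (σ i)) else 0#)
    termCong σ true  = Prod.⨀-cong (allFin k) (λ i → e i (σ i))
    termCong σ false = refl

  strike : ∀ {k N} → Fin N → (Fin (suc k) → Fin N → Carrier) → Fin k → Fin N → Carrier
  strike x A i y = if ⌊ y ≟ᶠ x ⌋ then 0# else A (suc i) y

  rectPerTerm-suc : ∀ k N (A : Fin (suc k) → Fin N → Carrier) (σ : Fin (suc k) → Fin N) →
    rectPerTerm (suc k) N A σ ≈ A zero (σ zero) * rectPerTerm k N (strike (σ zero) A) (λ i → σ (suc i))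
  -- σ is injective iff its tail is and misses σ zero; when only the latter fails,
  -- the struck column kills the product.
  rectPerTerm-suc k N A σ with isInjectiveᵇ (suc k) N σ in injσ | isInjectiveᵇ k N (λ i → σ (suc i)) in injσ'
  ... | true | true = begin
      ∏ (allFin (suc k)) (λ i → A i (σ i))                            ≡⟨ Prod.⨀-allFin-suc (λ i → A i (σ i)) ⟩
      A zero (σ zero) * ∏ (allFin k) (λ i → A (suc i) (σ (suc i)))    ≈⟨ *-congˡ (Prod.⨀-cong (allFin k) unstruck) ⟩
      A zero (σ zero) * ∏ (allFin k) (λ i → strike (σ zero) A i (σ (suc i))) ∎
    where
    unstruck : ∀ i → A (suc i) (σ (suc i)) ≈ strike (σ zero) A i (σ (suc i))
    unstruck i with σ (suc i) ≟ᶠ σ zero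
    ... | yes hit with () ← isInjectiveᵇ-sound σ injσ hit
    ... | no _    = refl
  ... | true | false with () ← P.trans (P.sym injσ')
        (isInjectiveᵇ-complete (λ i → σ (suc i)) (λ e → suc-injective (isInjectiveᵇ-sound σ injσ e)))
  ... | false | false = sym (zeroʳ _)
  ... | false | true with any? (λ i → σ (suc i) ≟ᶠ σ zero)
  ...   | yes (i , hit) = sym (trans (*-congˡ (∏-zero _ i struck)) (zeroʳ _))
    where
    struck : strike (σ zero) A i (σ (suc i)) ≈ 0#
    struck with σ (suc i) ≟ᶠ σ zero
    ... | yes _    = refl
    ... | no ¬hit  = contradiction hit ¬hit
  ...   | no miss = contradiction (P.trans (P.sym injσ) (isInjectiveᵇ-complete σ inj)) λ ()
    where
    injTail = isInjectiveᵇ-sound (λ i → σ (suc i)) injσ'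
    inj : Injective _≡_ _≡_ σ
    inj {zero}  {zero}  e = P.refl
    inj {zero}  {suc j} e = ⊥-elim (miss (j , P.sym e))
    inj {suc i} {zero}  e = ⊥-elim (miss (i , e))
    inj {suc i} {suc j} e = P.cong suc (injTail e)

  rectPer-expand : ∀ k N (A : Fin (suc k) → Fin N → Carrier) →
    rectPer (suc k) N A ≈ ∑ (allFin N) (λ x → A zero x * rectPer k N (strike x A))
  rectPer-expand k N A = trans (Sum.⨀-concatMap _ (allFin N) (rectPerTerm (suc k) N A))
    (Sum.⨀-cong (allFin N) λ x → begin
      _ ≡⟨ Sum.⨀-map _ (allFuns k (allFin N)) _ ⟩
      _ ≈⟨ Sum.⨀-cong (allFuns k (allFin N)) (λ σ → rectPerTerm-suc k N A _) ⟩
      _ ≈⟨ ∑-*ˡ (allFuns k (allFin N)) (A zero x) _ ⟩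
      A zero x * rectPer k N (strike x A) ∎)

  bools : List Bool
  bools = true ∷ false ∷ []

  allSubsets : (p : ℕ) → List (Subset p)
  allSubsets p = allFuns p bools

  allGrids : (q p : ℕ) → List (Grid q p)
  allGrids q p = allFuns q (allSubsets p)

  ∑-bools : (f : Bool → Carrier) → ∑ bools f ≈ f true + f false
  ∑-bools f = +-congˡ (+-identityʳ _)

  ∑-allFuns-suc : ∀ {a} {A : Set a} k (xs : List A) (f : (Fin (suc k) → A) → Carrier) → f Preserves _≗_ ⟶ _≈_ →
    ∑ (allFuns (suc k) xs) f ≈ ∑ xs (λ x → ∑ (allFuns k xs) (λ g → f (x ◂ g)))
  ∑-allFuns-suc k xs f f-resp = trans (Sum.⨀-concatMap _ xs f)
    (Sum.⨀-cong xs (λ x → trans (reflexive (Sum.⨀-map _ (allFuns k xs) f))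
      (Sum.⨀-cong (allFuns k xs) (λ g → f-resp λ { zero → P.refl ; (suc i) → P.refl }))))

  ∑-allSubsets-suc : ∀ p (f : Subset (suc p) → Carrier) → f Preserves _≗_ ⟶ _≈_ →
    ∑ (allSubsets (suc p)) f ≈ ∑ (allSubsets p) (λ S → f (true ◂ S)) + ∑ (allSubsets p) (λ S → f (false ◂ S))
  ∑-allSubsets-suc p f f-resp = trans (∑-allFuns-suc p bools f f-resp) (∑-bools (λ b → ∑ (allSubsets p) (λ S → f (b ◂ S))))

  ∑-allSubsets-∣∣ : ∀ p (h : Subset p → Carrier) → h Preserves _≗_ ⟶ _≈_ →
    ∑ (allFin p) (λ x → ∑ (allSubsets p) (λ S → if S x then 0# else h (insert S x)))
      ≈ ∑ (allSubsets p) (λ S → fromℕ 𝓡 ∣ S ∣ * h S)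
  ∑-allSubsets-∣∣ zero    h h-resp = sym (trans (+-identityʳ _) (zeroˡ _))
  ∑-allSubsets-∣∣ (suc p) h h-resp = begin
    ∑ (allFin (suc p)) (λ x → ∑ (allSubsets (suc p)) (avoid h x))
      ≡⟨ Sum.⨀-allFin-suc (λ x → ∑ (allSubsets (suc p)) (avoid h x)) ⟩
    ∑ (allSubsets (suc p)) (avoid h zero) + ∑ (allFin p) (λ x → ∑ (allSubsets (suc p)) (avoid h (suc x)))
      ≈⟨ +-cong atZero (Sum.⨀-cong (allFin p) atSuc) ⟩
    ∑P h₁ + ∑ (allFin p) (λ x → ∑P (avoid h₁ x) + ∑P (avoid h₀ x))
      ≈⟨ +-congˡ (trans (Sum.⨀-∙ (allFin p) _ _) (+-cong (∑-allSubsets-∣∣ p h₁ (head-resp true))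
                                                          (∑-allSubsets-∣∣ p h₀ (head-resp false)))) ⟩
    ∑P h₁ + (∑P (λ g → fromℕ 𝓡 ∣ g ∣ * h₁ g) + ∑P (λ g → fromℕ 𝓡 ∣ g ∣ * h₀ g))
      ≈⟨ sym (+-assoc _ _ _) ⟩
    (∑P h₁ + ∑P (λ g → fromℕ 𝓡 ∣ g ∣ * h₁ g)) + ∑P (λ g → fromℕ 𝓡 ∣ g ∣ * h₀ g)
      ≈⟨ +-cong (trans (sym (Sum.⨀-∙ (allSubsets p) _ _)) (Sum.⨀-cong (allSubsets p) λ g →
                  trans (+-congʳ (sym (*-identityˡ _))) (trans (sym (distribʳ _ _ _)) (*-congʳ (∣∣-head true g)))))
                (Sum.⨀-cong (allSubsets p) λ g → *-congʳ (∣∣-head false g)) ⟩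
    ∑P (λ g → fromℕ 𝓡 ∣ true ◂ g ∣ * h₁ g) + ∑P (λ g → fromℕ 𝓡 ∣ false ◂ g ∣ * h₀ g)
      ≈⟨ sym (∑-allSubsets-suc p (λ S → fromℕ 𝓡 ∣ S ∣ * h S) (λ e → *-cong (reflexive (P.cong (fromℕ 𝓡) (∣∣-cong e))) (h-resp e))) ⟩
    ∑ (allSubsets (suc p)) (λ S → fromℕ 𝓡 ∣ S ∣ * h S) ∎
    where
    ∑P : (Subset p → Carrier) → Carrier
    ∑P = ∑ (allSubsets p)
    avoid : ∀ {q} → (Subset q → Carrier) → Fin q → Subset q → Carrier
    avoid k x S = if S x then 0# else k (insert S x)
    h₁ h₀ : Subset p → Carrier
    h₁ g = h (true ◂ g)
    h₀ g = h (false ◂ g)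
    head-resp : ∀ b → (λ g → h (b ◂ g)) Preserves _≗_ ⟶ _≈_
    head-resp b e = h-resp λ { zero → P.refl ; (suc i) → e i }
    avoid-resp : ∀ x → avoid h x Preserves _≗_ ⟶ _≈_
    avoid-resp x {S} {S'} e rewrite e x with S' x
    ... | true  = refl
    ... | false = h-resp (λ y → P.cong (does (y ≟ᶠ x) ∨_) (e y))
    atZero : ∑ (allSubsets (suc p)) (avoid h zero) ≈ ∑P h₁
    atZero = trans (∑-allSubsets-suc p _ (avoid-resp zero))
      (trans (+-congʳ (Sum.⨀-ε (allSubsets p))) (trans (+-identityˡ _)
        (Sum.⨀-cong (allSubsets p) (λ g → h-resp λ { zero → P.refl ; (suc i) → P.refl }))))
    avoidTail : ∀ b g x → avoid h (suc x) (b ◂ g) ≈ avoid (λ g → h (b ◂ g)) x g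
    avoidTail b g x with g x
    ... | true  = refl
    ... | false = h-resp λ { zero → P.refl ; (suc i) → P.refl }
    atSuc : ∀ x → ∑ (allSubsets (suc p)) (avoid h (suc x)) ≈ ∑P (avoid h₁ x) + ∑P (avoid h₀ x)
    atSuc x = trans (∑-allSubsets-suc p _ (avoid-resp (suc x)))
      (+-cong (Sum.⨀-cong (allSubsets p) (λ g → avoidTail true g x)) (Sum.⨀-cong (allSubsets p) (λ g → avoidTail false g x)))
    ∣∣-head : ∀ b (g : Subset p) → fromℕ 𝓡 (boolToℕ b ℕ.+ ∣ g ∣) ≈ fromℕ 𝓡 ∣ b ◂ g ∣
    ∣∣-head b g = reflexive (P.cong (fromℕ 𝓡) (P.sym (∣∣-suc (b ◂ g))))

  -- xs lists every ~-class exactly once, expressed through the sums it computes.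
  SingleTermSum : ∀ {a r} {A : Set a} (_~_ : A → A → Set r) → List A → Set _
  SingleTermSum {A = A} _~_ xs = ∀ x₀ (f : A → Carrier) → f Preserves _~_ ⟶ _≈_ →
    (∀ x → ¬ (x ~ x₀) → f x ≈ 0#) → ∑ xs f ≈ f x₀

  singleTermSum-bools : SingleTermSum _≡_ bools
  singleTermSum-bools true  f _ f≈0 = trans (∑-bools f) (trans (+-congˡ (f≈0 false λ ())) (+-identityʳ _))
  singleTermSum-bools false f _ f≈0 = trans (∑-bools f) (trans (+-congʳ (f≈0 true λ ())) (+-identityˡ _))

  singleTermSum-allFuns : ∀ {a r} {A : Set a} (_~_ : A → A → Set r) (xs : List A) → (∀ x → x ~ x) →
    SingleTermSum _~_ xs → ∀ k → SingleTermSum (Pointwise _~_ {k}) (allFuns k xs)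
  singleTermSum-allFuns _~_ xs ~-refl single zero    x₀ f f-resp f≈0 = trans (+-identityʳ _) (f-resp λ ())
  singleTermSum-allFuns _~_ xs ~-refl single (suc k) x₀ f f-resp f≈0 = begin
    ∑ (allFuns (suc k) xs) f
      ≈⟨ ∑-allFuns-suc k xs f (λ e → f-resp (≗⇒Pointwise _~_ ~-refl e)) ⟩
    ∑ xs (λ x → ∑ (allFuns k xs) (λ g → f (x ◂ g)))
      ≈⟨ Sum.⨀-cong xs (λ x → singleTermSum-allFuns _~_ xs ~-refl single k (λ i → x₀ (suc i)) (λ g → f (x ◂ g))
           (λ e → f-resp λ { zero → ~-refl x ; (suc i) → e i })
           (λ g g≁ → f≈0 _ (λ e → g≁ (λ i → e (suc i))))) ⟩
    ∑ xs (λ x → f (x ◂ (λ i → x₀ (suc i))))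
      ≈⟨ single (x₀ zero) _ (λ e → f-resp λ { zero → e ; (suc i) → ~-refl _ }) (λ x x≁ → f≈0 _ (λ e → x≁ (e zero))) ⟩
    f (x₀ zero ◂ (λ i → x₀ (suc i)))
      ≈⟨ f-resp (λ { zero → ~-refl _ ; (suc i) → ~-refl _ }) ⟩
    f x₀ ∎

  singleTermSum-allSubsets : ∀ p → SingleTermSum (Pointwise _≡_ {p}) (allSubsets p)
  singleTermSum-allSubsets = singleTermSum-allFuns _≡_ bools (λ _ → P.refl) singleTermSum-bools

  ∑-allFuns-map : ∀ {a r} {A : Set a} (_~_ : A → A → Set r) (~-refl : ∀ x → x ~ x) (xs : List A) (φ : A → A) →
    (∀ g → g Preserves _~_ ⟶ _≈_ → ∑ xs g ≈ ∑ xs (λ x → g (φ x))) →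
    ∀ k (f : (Fin k → A) → Carrier) → f Preserves Pointwise _~_ ⟶ _≈_ →
    ∑ (allFuns k xs) f ≈ ∑ (allFuns k xs) (λ F → f (λ i → φ (F i)))
  ∑-allFuns-map _~_ ~-refl xs φ φ-invariant zero    f f-resp = +-congʳ (f-resp λ ())
  ∑-allFuns-map _~_ ~-refl xs φ φ-invariant (suc k) f f-resp = begin
    ∑ (allFuns (suc k) xs) f
      ≈⟨ ∑-allFuns-suc k xs f (λ e → f-resp (≗⇒Pointwise _~_ ~-refl e)) ⟩
    ∑ xs (λ x → ∑ (allFuns k xs) (λ G → f (x ◂ G)))
      ≈⟨ Sum.⨀-cong xs (λ x → ∑-allFuns-map _~_ ~-refl xs φ φ-invariant k (λ G → f (x ◂ G))
           (λ e → f-resp λ { zero → ~-refl x ; (suc i) → e i })) ⟩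
    ∑ xs (λ x → ∑ (allFuns k xs) (λ G → f (x ◂ (λ i → φ (G i)))))
      ≈⟨ φ-invariant _ (λ e → Sum.⨀-cong (allFuns k xs) (λ G → f-resp λ { zero → e ; (suc i) → ~-refl _ })) ⟩
    ∑ xs (λ x → ∑ (allFuns k xs) (λ G → f (φ x ◂ (λ i → φ (G i)))))
      ≈⟨ Sum.⨀-cong xs (λ x → Sum.⨀-cong (allFuns k xs) (λ G → f-resp λ { zero → ~-refl _ ; (suc i) → ~-refl _ })) ⟩
    ∑ xs (λ x → ∑ (allFuns k xs) (λ G → f (λ i → φ ((x ◂ G) i))))
      ≈⟨ sym (∑-allFuns-suc k xs (λ F → f (λ i → φ (F i))) (λ e → f-resp (≗⇒Pointwise _~_ ~-refl (λ i → P.cong φ (e i))))) ⟩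
    ∑ (allFuns (suc k) xs) (λ F → f (λ i → φ (F i))) ∎

  ∑-allSubsets-∁ : ∀ p (f : Subset p → Carrier) → f Preserves _≗_ ⟶ _≈_ →
    ∑ (allSubsets p) f ≈ ∑ (allSubsets p) (λ S → f (∁ S))
  ∑-allSubsets-∁ = ∑-allFuns-map _≡_ (λ _ → P.refl) bools not
    (λ g _ → trans (∑-bools g) (trans (+-comm _ _) (sym (∑-bools (λ x → g (not x))))))

  ∑-allGrids-∁ : ∀ m n (f : Grid m n → Carrier) → f Preserves _≗₂_ ⟶ _≈_ →
    ∑ (allGrids m n) f ≈ ∑ (allGrids m n) (λ D → f (λ i → ∁ (D i)))
  ∑-allGrids-∁ m n = ∑-allFuns-map _≗_ (λ _ _ → P.refl) (allSubsets n) ∁ (∑-allSubsets-∁ n) m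

  weight : ∀ {p} → (Fin p → Carrier) → Subset p → Carrier
  weight {p} v S = ∏ (allFin p) (λ y → if S y then v y else 1#)

  weight-cong : ∀ {p} (v : Fin p → Carrier) → weight v Preserves _≗_ ⟶ _≈_
  weight-cong {p} v e = Prod.⨀-cong (allFin p) (λ y → reflexive (P.cong (λ b → if b then v y else 1#) (e y)))

  weight-insert : ∀ {p} (v : Fin p → Carrier) S x → S x ≡ false → weight v (insert S x) ≈ v x * weight v S
  weight-insert {p} v S x x∉S = begin
    weight v (insert S x)
      ≈⟨ Prod.⨀-allFin-extract _ x ⟩
    (if does (x ≟ᶠ x) ∨ S x then v x else 1#) * rest (insert S x)
      ≡⟨ P.cong (λ b → (if b ∨ S x then v x else 1#) * rest (insert S x)) (dec-true (x ≟ᶠ x) P.refl) ⟩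
    v x * rest (insert S x)                       ≈⟨ *-congˡ (Prod.⨀-cong (allFin p) away) ⟩
    v x * rest S                                  ≈⟨ *-congˡ (sym (*-identityˡ _)) ⟩
    v x * (1# * rest S)                           ≡⟨ P.cong (λ b → v x * ((if b then v x else 1#) * rest S)) (P.sym x∉S) ⟩
    v x * ((if S x then v x else 1#) * rest S)    ≈⟨ *-congˡ (sym (Prod.⨀-allFin-extract _ x)) ⟩
    v x * weight v S                              ∎
    where
    rest : Subset p → Carrier
    rest T = ∏ (allFin p) (λ y → if does (y ≟ᶠ x) then 1# else (if T y then v y else 1#))
    away : ∀ y → (if does (y ≟ᶠ x) then 1# else (if insert S x y then v y else 1#))
               ≈ (if does (y ≟ᶠ x) then 1# else (if S y then v y else 1#))
    away y with does (y ≟ᶠ x)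
    ... | true  = refl
    ... | false = refl

  -- Choosing t distinct points outside s one after another, with weights v, and then
  -- continuing with H.  Each t-subset arises in t! orders, which is where the factorials come from.
  module OrderedChoice {p} (v : Fin p → Carrier) (H : Subset p → Carrier) (H-resp : H Preserves _≗_ ⟶ _≈_) where

    choices : ℕ → Subset p → Carrier
    choices zero    s = H s
    choices (suc t) s = ∑ (allFin p) λ x → (if s x then 0# else v x) * choices t (insert s x)

    choiceTerm : ℕ → Subset p → Subset p → Carrier
    choiceTerm t s S = guard (sizedDisjointᵇ t s S) (weight v S) (H (s ∪ S))

    choiceTerm-resp : ∀ t s → choiceTerm t s Preserves _≗_ ⟶ _≈_
    choiceTerm-resp t s e = guard-cong (sizedDisjointᵇ-cong t (λ _ → P.refl) e) (weight-cong v e)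
      (H-resp (λ y → P.cong (_∨ s y) (e y)))

    choiceTerm-insert : ∀ t s x S → (if s x then 0# else v x) * choiceTerm t (insert s x) S
                                  ≈ (if S x then 0# else choiceTerm (suc t) s (insert S x))
    choiceTerm-insert t s x S with S x in x∈?S | s x in x∈?s
    ... | true  | _     = trans (*-congˡ (guard-≡false _ _ (P.trans (P.cong ((∣ S ∣ ≡ᵇ t) ∧_)
                            (disjointᵇ-false S (insert s x) x x∈?S x∈insert)) (∧-zeroʳ _)))) (zeroʳ _)
      where x∈insert = P.cong (_∨ s x) (dec-true (x ≟ᶠ x) P.refl)
    ... | false | true  = trans (zeroˡ _) (sym (guard-≡false _ _ (P.trans (P.cong ((∣ insert S x ∣ ≡ᵇ suc t) ∧_)
                            (disjointᵇ-false (insert S x) s x x∈insert x∈?s)) (∧-zeroʳ _))))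
      where x∈insert = P.cong (_∨ S x) (dec-true (x ≟ᶠ x) P.refl)
    ... | false | false = begin
      v x * choiceTerm t (insert s x) S
        ≈⟨ *-congˡ (guard-cong (P.cong ((∣ S ∣ ≡ᵇ t) ∧_) (disjointᵇ-insertʳ S s x x∈?S)) refl refl) ⟩
      v x * guard (sizedDisjointᵇ t s S) (weight v S) (H (insert s x ∪ S))
        ≈⟨ guard-*ˡ _ _ _ _ ⟩
      guard (sizedDisjointᵇ t s S) (v x * weight v S) (H (insert s x ∪ S))
        ≈⟨ guard-cong (P.sym (P.cong₂ _∧_ (P.cong (_≡ᵇ suc t) (∣insert∣ S x x∈?S)) (disjointᵇ-insertˡ S s x x∈?S x∈?s)))
                      (sym (weight-insert v S x x∈?S)) (H-resp (λ y → ∨-reassoc (does (y ≟ᶠ x)) (S y) (s y))) ⟩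
      choiceTerm (suc t) s (insert S x) ∎

    ∣∣*choiceTerm : ∀ t s S → fromℕ 𝓡 ∣ S ∣ * choiceTerm t s S ≈ fromℕ 𝓡 t * choiceTerm t s S
    ∣∣*choiceTerm t s S = byCases (∣ S ∣ ≡ᵇ t) P.refl
      where
      byCases : ∀ b → (∣ S ∣ ≡ᵇ t) ≡ b → fromℕ 𝓡 ∣ S ∣ * choiceTerm t s S ≈ fromℕ 𝓡 t * choiceTerm t s S
      byCases true  sized = reflexive (P.cong (λ k → fromℕ 𝓡 k * choiceTerm t s S) (≡ᵇ⇒≡ {∣ S ∣} sized))
      byCases false sized = trans (*-congˡ vanish) (trans (zeroʳ _) (sym (trans (*-congˡ vanish) (zeroʳ _))))
        where vanish = guard-≡false _ _ (P.cong (_∧ disjointᵇ S s) sized)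

    choices≈ : ∀ t s → choices t s ≈ fromℕ 𝓡 (t !) * ∑ (allSubsets p) (choiceTerm t s)
    choices≈ zero s = begin
      H s                                          ≈⟨ sym (*-identityˡ _) ⟩
      guard true 1# (H (s ∪ (λ _ → false)))        ≈⟨ guard-cong (P.sym chooseNothing) (sym (Prod.⨀-ε (allFin p))) refl ⟩
      choiceTerm 0 s (λ _ → false)
        ≈⟨ sym (singleTermSum-allSubsets p (λ _ → false) (choiceTerm 0 s) (choiceTerm-resp 0 s) nonempty) ⟩
      ∑ (allSubsets p) (choiceTerm 0 s)            ≈⟨ sym (*-identityˡ _) ⟩
      1# * ∑ (allSubsets p) (choiceTerm 0 s)       ≈⟨ *-congʳ (sym (+-identityʳ _)) ⟩
      fromℕ 𝓡 1 * ∑ (allSubsets p) (choiceTerm 0 s) ∎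
      where
      chooseNothing : sizedDisjointᵇ 0 s (λ _ → false) ≡ true
      chooseNothing = P.trans (P.cong (λ k → (k ≡ᵇ 0) ∧ disjointᵇ (λ _ → false) s) (∣∅∣ {p}))
        (and-const-true (allFin p))
      nonempty : ∀ S → ¬ Pointwise _≡_ S (λ _ → false) → choiceTerm 0 s S ≈ 0#
      nonempty S S≉∅ = byCases (∣ S ∣ ≡ᵇ 0) P.refl
        where
        byCases : ∀ b → (∣ S ∣ ≡ᵇ 0) ≡ b → choiceTerm 0 s S ≈ 0#
        byCases true  sized = contradiction (∣S∣≡0⇒S≗∅ S (≡ᵇ⇒≡ {∣ S ∣} sized)) S≉∅
        byCases false sized = guard-≡false _ _ (P.cong (_∧ disjointᵇ S s) sized)
    choices≈ (suc t) s = begin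
      ∑ (allFin p) (λ x → a x * choices t (insert s x))
        ≈⟨ Sum.⨀-cong (allFin p) (λ x → *-congˡ (choices≈ t (insert s x))) ⟩
      ∑ (allFin p) (λ x → a x * (t! * ∑ (allSubsets p) (choiceTerm t (insert s x))))
        ≈⟨ Sum.⨀-cong (allFin p) (λ x → trans (x∙yz≈y∙xz _ _ _) (*-congˡ (sym (∑-*ˡ (allSubsets p) (a x) _)))) ⟩
      ∑ (allFin p) (λ x → t! * ∑ (allSubsets p) (λ S → a x * choiceTerm t (insert s x) S))
        ≈⟨ ∑-*ˡ (allFin p) t! _ ⟩
      t! * ∑ (allFin p) (λ x → ∑ (allSubsets p) (λ S → a x * choiceTerm t (insert s x) S))
        ≈⟨ *-congˡ (Sum.⨀-cong (allFin p) (λ x → Sum.⨀-cong (allSubsets p) (λ S → choiceTerm-insert t s x S))) ⟩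
      t! * ∑ (allFin p) (λ x → ∑ (allSubsets p) (λ S → if S x then 0# else choiceTerm (suc t) s (insert S x)))
        ≈⟨ *-congˡ (∑-allSubsets-∣∣ p (choiceTerm (suc t) s) (choiceTerm-resp (suc t) s)) ⟩
      t! * ∑ (allSubsets p) (λ S → fromℕ 𝓡 ∣ S ∣ * choiceTerm (suc t) s S)
        ≈⟨ *-congˡ (Sum.⨀-cong (allSubsets p) (∣∣*choiceTerm (suc t) s)) ⟩
      t! * ∑ (allSubsets p) (λ S → fromℕ 𝓡 (suc t) * choiceTerm (suc t) s S)
        ≈⟨ *-congˡ (∑-*ˡ (allSubsets p) _ _) ⟩
      t! * (fromℕ 𝓡 (suc t) * ∑ (allSubsets p) (choiceTerm (suc t) s))
        ≈⟨ sym (*-assoc _ _ _) ⟩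
      (t! * fromℕ 𝓡 (suc t)) * ∑ (allSubsets p) (choiceTerm (suc t) s)
        ≈⟨ *-congʳ (trans (*-comm _ _) (sym (fromℕ-* (suc t) (t !)))) ⟩
      fromℕ 𝓡 (suc t !) * ∑ (allSubsets p) (choiceTerm (suc t) s) ∎
      where
      t! = fromℕ 𝓡 (t !)
      a : Fin p → Carrier
      a x = if s x then 0# else v x

  choices-cong : ∀ {p} (v : Fin p → Carrier) (H H' : Subset p → Carrier)
    (H-resp : H Preserves _≗_ ⟶ _≈_) (H'-resp : H' Preserves _≗_ ⟶ _≈_) →
    (∀ s → H s ≈ H' s) → ∀ t {s s'} → s ≗ s' →
    OrderedChoice.choices v H H-resp t s ≈ OrderedChoice.choices v H' H'-resp t s'
  -- Through the closed form, where H occurs only under a congruence.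
  choices-cong {p} v H H' H-resp H'-resp H≈H' t {s} {s'} s≗s' = begin
    OrderedChoice.choices v H H-resp t s
      ≈⟨ OrderedChoice.choices≈ v H H-resp t s ⟩
    fromℕ 𝓡 (t !) * ∑ (allSubsets p) (OrderedChoice.choiceTerm v H H-resp t s)
      ≈⟨ *-congˡ (Sum.⨀-cong (allSubsets p) λ S → guard-cong (sizedDisjointᵇ-cong t s≗s' (λ _ → P.refl)) refl
           (trans (H≈H' _) (H'-resp (λ y → P.cong (S y ∨_) (s≗s' y))))) ⟩
    fromℕ 𝓡 (t !) * ∑ (allSubsets p) (OrderedChoice.choiceTerm v H' H'-resp t s')
      ≈⟨ sym (OrderedChoice.choices≈ v H' H'-resp t s') ⟩
    OrderedChoice.choices v H' H'-resp t s' ∎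

  -- A size(a)-subset of free cells is chosen in every line a: lineByLine nests the closed forms
  -- of choices≈ line after line, allAtOnce sums over whole families of subsets.
  module LineChoices {q p : ℕ} (size : Fin q → ℕ) (v : Fin q → Fin p → Carrier) where

    lineByLine : List (Fin q) → (Grid q p → Carrier) → Grid q p → Carrier
    lineByLine []       H Z = H Z
    lineByLine (a ∷ as) H Z = fromℕ 𝓡 (size a !) * ∑ (allSubsets p) λ S →
      guard (sizedDisjointᵇ (size a) (Z a) S) (weight (v a) S) (lineByLine as H (updateLine Z a (Z a ∪ S)))

    lineByLine-resp : ∀ as H → H Preserves _≗₂_ ⟶ _≈_ → lineByLine as H Preserves _≗₂_ ⟶ _≈_
    lineByLine-resp []       H H-resp = H-resp
    lineByLine-resp (a ∷ as) H H-resp e = *-congˡ (Sum.⨀-cong (allSubsets p) λ S →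
      guard-cong (sizedDisjointᵇ-cong (size a) (e a) (λ _ → P.refl)) refl
        (lineByLine-resp as H H-resp (updateLine-cong a e (λ y → P.cong (S y ∨_) (e a y)))))

    allLinesᵇ : Grid q p → Grid q p → Bool
    allLinesᵇ S Z = and (map (λ a → sizedDisjointᵇ (size a) (Z a) (S a)) (allFin q))

    familyWeight : Grid q p → Carrier
    familyWeight S = ∏ (allFin q) (λ a → weight (v a) (S a))

    allAtOnce : (Grid q p → Carrier) → Grid q p → Carrier
    allAtOnce H Z = fromℕ 𝓡 (prodℕ q (λ a → size a !)) * ∑ (allGrids q p) λ S →
      guard (allLinesᵇ S Z) (familyWeight S) (H (Z ∪₂ S))

  lineByLine-map-suc : ∀ {q p} (size : Fin (suc q) → ℕ) (v : Fin (suc q) → Fin p → Carrier) as H →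
    H Preserves _≗₂_ ⟶ _≈_ → ∀ Z →
    LineChoices.lineByLine size v (map suc as) H Z ≈
      LineChoices.lineByLine (λ a → size (suc a)) (λ a → v (suc a)) as (λ Z' → H (Z zero ◂ Z')) (λ a → Z (suc a))
  lineByLine-map-suc size v []       H H-resp Z = H-resp λ { zero b → P.refl ; (suc a) b → P.refl }
  lineByLine-map-suc {p = p} size v (a ∷ as) H H-resp Z = *-congˡ (Sum.⨀-cong (allSubsets p) λ S → *-congˡ
    (lineByLine-map-suc size v as H H-resp (updateLine Z (suc a) (Z (suc a) ∪ S))))

  allAtOnce-suc : ∀ {q p} (size : Fin (suc q) → ℕ) (v : Fin (suc q) → Fin p → Carrier) H →
    H Preserves _≗₂_ ⟶ _≈_ → ∀ Z →
    LineChoices.allAtOnce size v H Z ≈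
      fromℕ 𝓡 (size zero !) * ∑ (allSubsets p) (λ S₀ → guard (sizedDisjointᵇ (size zero) (Z zero) S₀) (weight (v zero) S₀)
        (LineChoices.allAtOnce (λ a → size (suc a)) (λ a → v (suc a)) (λ Z' → H ((Z zero ∪ S₀) ◂ Z')) (λ a → Z (suc a))))
  allAtOnce-suc {q} {p} size v H H-resp Z = begin
    fromℕ 𝓡 (prodℕ (suc q) (λ a → size a !)) * ∑ (allGrids (suc q) p) f
      ≈⟨ *-cong factorials (∑-allFuns-suc q (allSubsets p) f f-resp) ⟩
    (F₀ * F') * ∑ (allSubsets p) (λ S₀ → ∑ (allGrids q p) (λ S' → f (S₀ ◂ S')))
      ≈⟨ *-congˡ (Sum.⨀-cong (allSubsets p) λ S₀ → Sum.⨀-cong (allGrids q p) (split S₀)) ⟩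
    (F₀ * F') * ∑ (allSubsets p) (λ S₀ → ∑ (allGrids q p) (λ S' → guard (b₀ S₀) (w₀ S₀) (rest S₀ S')))
      ≈⟨ *-assoc _ _ _ ⟩
    F₀ * (F' * ∑ (allSubsets p) (λ S₀ → ∑ (allGrids q p) (λ S' → guard (b₀ S₀) (w₀ S₀) (rest S₀ S'))))
      ≈⟨ *-congˡ (sym (∑-*ˡ (allSubsets p) F' _)) ⟩
    F₀ * ∑ (allSubsets p) (λ S₀ → F' * ∑ (allGrids q p) (λ S' → guard (b₀ S₀) (w₀ S₀) (rest S₀ S')))
      ≈⟨ *-congˡ (Sum.⨀-cong (allSubsets p) λ S₀ →
           trans (*-congˡ (sym (guard-∑ (b₀ S₀) (w₀ S₀) (allGrids q p) (rest S₀)))) (sym (guard-*ʳ (b₀ S₀) (w₀ S₀) F' _))) ⟩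
    F₀ * ∑ (allSubsets p) (λ S₀ → guard (b₀ S₀) (w₀ S₀) (F' * ∑ (allGrids q p) (rest S₀))) ∎
    where
    open LineChoices size v
    module Tail = LineChoices (λ a → size (suc a)) (λ a → v (suc a))
    F₀ = fromℕ 𝓡 (size zero !)
    F' = fromℕ 𝓡 (prodℕ q (λ a → size (suc a) !))
    b₀ : Subset p → Bool
    b₀ S₀ = sizedDisjointᵇ (size zero) (Z zero) S₀
    w₀ : Subset p → Carrier
    w₀ S₀ = weight (v zero) S₀
    rest : Subset p → Grid q p → Carrier
    rest S₀ S' = guard (Tail.allLinesᵇ S' (λ a → Z (suc a))) (Tail.familyWeight S')
                   (H ((Z zero ∪ S₀) ◂ ((λ a → Z (suc a)) ∪₂ S')))
    f : Grid (suc q) p → Carrier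
    f S = guard (allLinesᵇ S Z) (familyWeight S) (H (Z ∪₂ S))
    f-resp : f Preserves _≗_ ⟶ _≈_
    f-resp e = guard-cong (P.cong and (map-cong (λ a → sizedDisjointᵇ-cong (size a) (λ _ → P.refl) (P.cong-app (e a))) (allFin (suc q))))
      (Prod.⨀-cong (allFin (suc q)) (λ a → reflexive (P.cong (weight (v a)) (e a))))
      (H-resp (λ a b → P.cong (λ s → (Z a ∪ s) b) (e a)))
    factorials : fromℕ 𝓡 (prodℕ (suc q) (λ a → size a !)) ≈ F₀ * F'
    factorials = trans (reflexive (P.cong (fromℕ 𝓡) (P.cong (foldr ℕ._*_ 1) (map-allFin-suc (λ a → size a !)))))
      (fromℕ-* (size zero !) (prodℕ q (λ a → size (suc a) !)))
    split : ∀ S₀ S' → f (S₀ ◂ S') ≈ guard (b₀ S₀) (w₀ S₀) (rest S₀ S')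
    split S₀ S' = trans
      (guard-cong (P.cong and (map-allFin-suc (λ a → sizedDisjointᵇ (size a) (Z a) ((S₀ ◂ S') a))))
                  (reflexive (Prod.⨀-allFin-suc (λ a → weight (v a) ((S₀ ◂ S') a))))
                  (H-resp λ { zero b → P.refl ; (suc a) b → P.refl }))
      (guard-∧ (b₀ S₀) _ (w₀ S₀) _ (H ((Z zero ∪ S₀) ◂ ((λ a → Z (suc a)) ∪₂ S'))))

  lineByLine≈allAtOnce : ∀ q {p} (size : Fin q → ℕ) (v : Fin q → Fin p → Carrier) H →
    H Preserves _≗₂_ ⟶ _≈_ → ∀ Z →
    LineChoices.lineByLine size v (allFin q) H Z ≈ LineChoices.allAtOnce size v H Z
  lineByLine≈allAtOnce zero    size v H H-resp Z = trans (H-resp λ ())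
    (sym (trans (*-congʳ (+-identityʳ 1#)) (trans (*-identityˡ _) (trans (+-identityʳ _) (*-identityˡ _)))))
  lineByLine≈allAtOnce (suc q) {p} size v H H-resp Z = begin
    lineByLine (allFin (suc q)) H Z
      ≡⟨ P.cong (λ as → lineByLine (zero ∷ as) H Z) (P.sym (map-tabulate id suc)) ⟩
    fromℕ 𝓡 (size zero !) * ∑ (allSubsets p) (λ S₀ → guard (b₀ S₀) (weight (v zero) S₀) (lineByLine (map suc (allFin q)) H (Z₁ S₀)))
      ≈⟨ *-congˡ (Sum.⨀-cong (allSubsets p) λ S₀ → *-congˡ (trans
           (lineByLine-map-suc size v (allFin q) H H-resp (Z₁ S₀))
           (lineByLine≈allAtOnce q _ _ _ (λ e → H-resp λ { zero b → P.refl ; (suc a) → e a }) (λ a → Z (suc a))))) ⟩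
    _ ≈⟨ sym (allAtOnce-suc size v H H-resp Z) ⟩
    allAtOnce H Z ∎
    where
    open LineChoices size v
    b₀ : Subset p → Bool
    b₀ S₀ = sizedDisjointᵇ (size zero) (Z zero) S₀
    Z₁ : Subset p → Grid (suc q) p
    Z₁ S₀ = updateLine Z zero (Z zero ∪ S₀)

  ∑-combine : ∀ m n (h : Fin (m ℕ.* n) → Carrier) →
    ∑ (allFin (m ℕ.* n)) h ≈ ∑ (allFin m) (λ i → ∑ (allFin n) (λ j → h (combine i j)))
  ∑-combine zero    n h = refl
  ∑-combine (suc m) n h = begin
    ∑ (allFin (n ℕ.+ m ℕ.* n)) h
      ≈⟨ Sum.⨀-allFin-+ n (m ℕ.* n) h ⟩
    ∑ (allFin n) (λ j → h (j ↑ˡ (m ℕ.* n))) + ∑ (allFin (m ℕ.* n)) (λ k → h (n ↑ʳ k))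
      ≈⟨ +-congˡ (∑-combine m n (λ k → h (n ↑ʳ k))) ⟩
    ∑ (allFin n) (λ j → h (combine {suc m} zero j)) + ∑ (allFin m) (λ i → ∑ (allFin n) (λ j → h (combine {suc m} (suc i) j)))
      ≡⟨ P.sym (Sum.⨀-allFin-suc {k = m} (λ i → ∑ (allFin n) (λ j → h (combine {suc m} {n} i j)))) ⟩
    ∑ (allFin (suc m)) (λ i → ∑ (allFin n) (λ j → h (combine i j))) ∎

  -- Cell (i, j) is column j of column block i of A; K records the cells occupied so far.
  module RowExpansion (m n : ℕ) (R : Fin m → ℕ) (C : Fin n → ℕ) (W : Fin m → Fin n → Carrier) where

    ent : RowLabel m n → Fin m → Fin n → Carrier
    ent = entry 𝓡 m n R C W

    occupy : Grid m n → Fin m → Fin n → Grid m n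
    occupy K i j a b = (⌊ a ≟ᶠ i ⌋ ∧ ⌊ b ≟ᶠ j ⌋) ∨ K a b

    expand : List (RowLabel m n) → (Grid m n → Carrier) → Grid m n → Carrier
    expand []        G K = G K
    expand (ℓb ∷ L) G K = ∑ (allFin m) λ i → ∑ (allFin n) λ j →
      (if K i j then 0# else ent ℓb i j) * expand L G (occupy K i j)

    expand-resp : ∀ L G → G Preserves _≗₂_ ⟶ _≈_ → expand L G Preserves _≗₂_ ⟶ _≈_
    expand-resp []        G G-resp = G-resp
    expand-resp (ℓb ∷ L) G G-resp {K} {K'} e = Sum.⨀-cong (allFin m) λ i → Sum.⨀-cong (allFin n) λ j →
      entryCong (e i j) (expand-resp L G G-resp (λ a b → P.cong (_ ∨_) (e a b)))
      where
      entryCong : ∀ {i j x x'} → K i j ≡ K' i j → x ≈ x' →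
        (if K i j then 0# else ent ℓb i j) * x ≈ (if K' i j then 0# else ent ℓb i j) * x'
      entryCong eq x≈x' rewrite eq = *-congˡ x≈x'

    expand-++ : ∀ L₁ L₂ G K → expand (L₁ ++ L₂) G K ≈ expand L₁ (expand L₂ G) K
    expand-++ []         L₂ G K = refl
    expand-++ (ℓb ∷ L₁) L₂ G K = Sum.⨀-cong (allFin m) λ i → Sum.⨀-cong (allFin n) λ j →
      *-congˡ (expand-++ L₁ L₂ G _)

    labelEntry : Maybe (RowLabel m n) → Fin m × Fin n → Carrier
    labelEntry (just ℓb) (i , j) = ent ℓb i j
    labelEntry nothing   _       = 0#

    labelMatrix : ∀ k → List (RowLabel m n) → (Fin (m ℕ.* n) → Bool) → Fin k → Fin (m ℕ.* n) → Carrier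
    labelMatrix k L occupied r col = if occupied col then 0# else labelEntry (lookupMaybe L (toℕ r)) (remQuot n col)

    matA≈labelMatrix : ∀ r col → matA 𝓡 m n R C W r col ≈ labelMatrix (m ℕ.* n) (rowLabels 𝓡 m n R C W) (λ _ → false) r col
    matA≈labelMatrix r col with lookupMaybe (rowLabels 𝓡 m n R C W) (toℕ r) | remQuot {m} n col
    ... | just ℓb | (i , j) = refl
    ... | nothing | _       = refl

    combine-≟ : ∀ (a i : Fin m) (b j : Fin n) → ⌊ combine a b ≟ᶠ combine i j ⌋ ≡ (⌊ a ≟ᶠ i ⌋ ∧ ⌊ b ≟ᶠ j ⌋)
    combine-≟ a i b j with combine a b ≟ᶠ combine i j | a ≟ᶠ i | b ≟ᶠ j
    ... | yes _    | yes _      | yes _      = P.refl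
    ... | yes eq   | no a≢i     | _          = contradiction (proj₁ (combine-injective a b i j eq)) a≢i
    ... | yes eq   | yes _      | no b≢j     = contradiction (proj₂ (combine-injective a b i j eq)) b≢j
    ... | no ne    | yes P.refl | yes P.refl = contradiction P.refl ne
    ... | no _     | yes _      | no _       = P.refl
    ... | no _     | no _       | _          = P.refl

    rectPer≈expand : ∀ L k occupied → length L ≡ k →
      rectPer k (m ℕ.* n) (labelMatrix k L occupied) ≈ expand L (λ _ → 1#) (λ i j → occupied (combine i j))
    rectPer≈expand []        zero    occupied _   = +-identityʳ _
    rectPer≈expand (ℓb ∷ L) (suc k) occupied len = begin
      rectPer (suc k) N M
        ≈⟨ rectPer-expand k N M ⟩
      ∑ (allFin N) (λ x → M zero x * rectPer k N (strike x M))
        ≈⟨ Sum.⨀-cong (allFin N) (λ x → *-congˡ (trans (rectPer-cong k N _ _ (strike≈ x))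
                                                   (rectPer≈expand L k (occupied' x) (ℕP.suc-injective len)))) ⟩
      ∑ (allFin N) (λ x → M zero x * expand L (λ _ → 1#) (λ i j → occupied' x (combine i j)))
        ≈⟨ ∑-combine m n _ ⟩
      ∑ (allFin m) (λ i → ∑ (allFin n) (λ j → M zero (combine i j) * expand L (λ _ → 1#) (λ a b → occupied' (combine i j) (combine a b))))
        ≈⟨ Sum.⨀-cong (allFin m) (λ i → Sum.⨀-cong (allFin n) (λ j → *-cong (firstRow i j)
             (expand-resp L (λ _ → 1#) (λ _ → refl) (λ a b → P.cong (_∨ occupied (combine a b)) (combine-≟ a i b j))))) ⟩
      expand (ℓb ∷ L) (λ _ → 1#) (λ i j → occupied (combine i j)) ∎
      where
      N = m ℕ.* n
      M = labelMatrix (suc k) (ℓb ∷ L) occupied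
      occupied' : Fin N → Fin N → Bool
      occupied' x y = ⌊ y ≟ᶠ x ⌋ ∨ occupied y
      strike≈ : ∀ x i y → strike x M i y ≈ labelMatrix k L (occupied' x) i y
      strike≈ x i y with y ≟ᶠ x
      ... | yes _ = refl
      ... | no _  = refl
      firstRow : ∀ i j → M zero (combine i j) ≈ (if occupied (combine i j) then 0# else ent ℓb i j)
      firstRow i j = reflexive (P.cong (λ ij → if occupied (combine i j) then 0# else labelEntry (just ℓb) ij)
                                       (remQuot-combine {m} {n} i j))

  updateLine-resp : ∀ {q p} (G : Grid q p → Carrier) → G Preserves _≗₂_ ⟶ _≈_ →
    ∀ K a → (λ s → G (updateLine K a s)) Preserves _≗_ ⟶ _≈_
  updateLine-resp G G-resp K a s≗s' = G-resp (updateLine-cong a (λ _ _ → P.refl) s≗s')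

  updateColumn-resp : ∀ {q p} (G : Grid q p → Carrier) → G Preserves _≗₂_ ⟶ _≈_ →
    ∀ K b → (λ s → G (updateColumn K b s)) Preserves _≗_ ⟶ _≈_
  updateColumn-resp G G-resp K b s≗s' = G-resp λ a b' → updateLine-cong {Z = transpose K} b (λ _ _ → P.refl) s≗s' b' a

  module BlockExpansion (m n : ℕ) (R : Fin m → ℕ) (C : Fin n → ℕ) (W : Fin m → Fin n → Carrier) where
    open RowExpansion m n R C W

    private
      vanishing : ∀ b x X → x ≡ 0# → (if b then 0# else x) * X ≈ 0#
      vanishing true  x X _      = zeroˡ X
      vanishing false x X P.refl = zeroˡ X

      ifFree-cong : ∀ b {x y : Carrier} → x ≡ y → (if b then 0# else x) ≡ (if b then 0# else y)
      ifFree-cong b P.refl = P.refl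

      entI-other : ∀ (i a : Fin m) → a ≢ i → (if ⌊ i ≟ᶠ a ⌋ then 1# else 0#) ≡ 0#
      entI-other i a a≢i with i ≟ᶠ a
      ... | yes i≡a = contradiction (P.sym i≡a) a≢i
      ... | no _    = P.refl

      entI-same : ∀ (i : Fin m) → (if ⌊ i ≟ᶠ i ⌋ then 1# else 0#) ≡ 1#
      entI-same i with i ≟ᶠ i
      ... | yes _  = P.refl
      ... | no i≢i = contradiction P.refl i≢i

      entII-other : ∀ (j b : Fin n) (a : Fin m) → b ≢ j → (if ⌊ j ≟ᶠ b ⌋ then W a b else 0#) ≡ 0#
      entII-other j b a b≢j with j ≟ᶠ b
      ... | yes j≡b = contradiction (P.sym j≡b) b≢j
      ... | no _    = P.refl

      entII-same : ∀ (j : Fin n) (a : Fin m) → (if ⌊ j ≟ᶠ j ⌋ then W a j else 0#) ≡ W a j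
      entII-same j a with j ≟ᶠ j
      ... | yes _  = P.refl
      ... | no j≢j = contradiction P.refl j≢j

    expand-typeI : ∀ t i G (G-resp : G Preserves _≗₂_ ⟶ _≈_) K →
      expand (replicate t (typeI i)) G K ≈
        OrderedChoice.choices (λ _ → 1#) (λ s → G (updateLine K i s)) (updateLine-resp G G-resp K i) t (K i)
    expand-typeI zero    i G G-resp K = G-resp notUpdated
      where
      notUpdated : K ≗₂ updateLine K i (K i)
      notUpdated a b with a ≟ᶠ i
      ... | yes P.refl = P.refl
      ... | no _       = P.refl
    expand-typeI (suc t) i G G-resp K = begin
      ∑ (allFin m) (λ a → ∑ (allFin n) (λ b → (if K a b then 0# else ent (typeI i) a b) * rest a b))
        ≈⟨ Sum.⨀-allFin-single _ i (λ a a≢i → trans (Sum.⨀-cong (allFin n) (λ b → vanishing (K a b) _ _ (entI-other i a a≢i)))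
                                                   (Sum.⨀-ε (allFin n))) ⟩
      ∑ (allFin n) (λ b → (if K i b then 0# else ent (typeI i) i b) * rest i b)
        ≈⟨ Sum.⨀-cong (allFin n) (λ b → *-cong (reflexive (ifFree-cong (K i b) (entI-same i))) (trans
             (expand-typeI t i G G-resp (occupy K i b))
             (choices-cong (λ _ → 1#) _ _ (updateLine-resp G G-resp (occupy K i b) i) (updateLine-resp G G-resp K i)
                (λ s → G-resp (sameUpdate b s)) t {s' = insert (K i) b} (occupyRow b)))) ⟩
      OrderedChoice.choices (λ _ → 1#) (λ s → G (updateLine K i s)) (updateLine-resp G G-resp K i) (suc t) (K i) ∎
      where
      rest : Fin m → Fin n → Carrier
      rest a b = expand (replicate t (typeI i)) G (occupy K a b)
      sameUpdate : ∀ b s → updateLine (occupy K i b) i s ≗₂ updateLine K i s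
      sameUpdate b s a' b' with a' ≟ᶠ i
      ... | yes _ = P.refl
      ... | no _  = P.refl
      occupyRow : ∀ b → occupy K i b i ≗ insert (K i) b
      occupyRow b y with i ≟ᶠ i | y ≟ᶠ b
      ... | yes _  | yes _ = P.refl
      ... | yes _  | no _  = P.refl
      ... | no i≢i | _     = contradiction P.refl i≢i

    expand-typeII : ∀ t j G (G-resp : G Preserves _≗₂_ ⟶ _≈_) K →
      expand (replicate t (typeII j)) G K ≈
        OrderedChoice.choices (λ a → W a j) (λ T → G (updateColumn K j T)) (updateColumn-resp G G-resp K j) t (λ a → K a j)
    expand-typeII zero    j G G-resp K = G-resp notUpdated
      where
      notUpdated : K ≗₂ updateColumn K j (λ a → K a j)
      notUpdated a b with b ≟ᶠ j
      ... | yes P.refl = P.refl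
      ... | no _       = P.refl
    expand-typeII (suc t) j G G-resp K = begin
      ∑ (allFin m) (λ a → ∑ (allFin n) (λ b → (if K a b then 0# else ent (typeII j) a b) * rest a b))
        ≈⟨ Sum.⨀-cong (allFin m) (λ a → Sum.⨀-allFin-single _ j (λ b b≢j → vanishing (K a b) _ _ (entII-other j b a b≢j))) ⟩
      ∑ (allFin m) (λ a → (if K a j then 0# else ent (typeII j) a j) * rest a j)
        ≈⟨ Sum.⨀-cong (allFin m) (λ a → *-cong (reflexive (ifFree-cong (K a j) (entII-same j a))) (trans
             (expand-typeII t j G G-resp (occupy K a j))
             (choices-cong (λ a → W a j) _ _ (updateColumn-resp G G-resp (occupy K a j) j) (updateColumn-resp G G-resp K j)
                (λ T → G-resp (sameUpdate a T)) t {s' = insert (λ a' → K a' j) a} (occupyColumn a)))) ⟩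
      OrderedChoice.choices (λ a → W a j) (λ T → G (updateColumn K j T)) (updateColumn-resp G G-resp K j) (suc t) (λ a → K a j) ∎
      where
      rest : Fin m → Fin n → Carrier
      rest a b = expand (replicate t (typeII j)) G (occupy K a b)
      sameUpdate : ∀ a T → updateColumn (occupy K a j) j T ≗₂ updateColumn K j T
      sameUpdate a T a' b' with b' ≟ᶠ j
      ... | yes _ = P.refl
      ... | no _  = P.cong (_∨ K a' b') (∧-zeroʳ ⌊ a' ≟ᶠ a ⌋)
      occupyColumn : ∀ a → (λ a' → occupy K a j a' j) ≗ insert (λ a' → K a' j) a
      occupyColumn a y with y ≟ᶠ a | j ≟ᶠ j
      ... | yes _ | yes _  = P.refl
      ... | no _  | yes _  = P.refl
      ... | _     | no j≢j = contradiction P.refl j≢j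

    typeIRows : (Fin m → ℕ) → List (Fin m) → List (RowLabel m n)
    typeIRows t is = concatMap (λ i → replicate (t i) (typeI i)) is

    typeIIRows : List (Fin n) → List (RowLabel m n)
    typeIIRows js = concatMap (λ j → replicate (C j) (typeII j)) js

    expand-typeIRows : ∀ t is G → G Preserves _≗₂_ ⟶ _≈_ → ∀ K →
      expand (typeIRows t is) G K ≈ LineChoices.lineByLine t (λ _ _ → 1#) is G K
    expand-typeIRows t []       G G-resp K = refl
    expand-typeIRows t (i ∷ is) G G-resp K = begin
      expand (replicate (t i) (typeI i) ++ typeIRows t is) G K
        ≈⟨ expand-++ (replicate (t i) (typeI i)) (typeIRows t is) G K ⟩
      expand (replicate (t i) (typeI i)) (expand (typeIRows t is) G) K
        ≈⟨ expand-typeI (t i) i (expand (typeIRows t is) G) (expand-resp (typeIRows t is) G G-resp) K ⟩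
      OrderedChoice.choices (λ _ → 1#) H H-resp (t i) (K i)
        ≈⟨ choices-cong (λ _ → 1#) H H' H-resp H'-resp (λ s → expand-typeIRows t is G G-resp (updateLine K i s)) (t i) (λ _ → P.refl) ⟩
      OrderedChoice.choices (λ _ → 1#) H' H'-resp (t i) (K i)
        ≈⟨ OrderedChoice.choices≈ (λ _ → 1#) H' H'-resp (t i) (K i) ⟩
      LineChoices.lineByLine t (λ _ _ → 1#) (i ∷ is) G K ∎
      where
      H H' : Subset n → Carrier
      H  s = expand (typeIRows t is) G (updateLine K i s)
      H' s = LineChoices.lineByLine t (λ _ _ → 1#) is G (updateLine K i s)
      H-resp : H Preserves _≗_ ⟶ _≈_
      H-resp = updateLine-resp _ (expand-resp (typeIRows t is) G G-resp) K i
      H'-resp : H' Preserves _≗_ ⟶ _≈_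
      H'-resp = updateLine-resp _ (LineChoices.lineByLine-resp t (λ _ _ → 1#) is G G-resp) K i

    expand-typeIIRows : ∀ js G → G Preserves _≗₂_ ⟶ _≈_ → ∀ K →
      expand (typeIIRows js) G K ≈ LineChoices.lineByLine C (λ j a → W a j) js (λ Z → G (transpose Z)) (transpose K)
    expand-typeIIRows []       G G-resp K = refl
    expand-typeIIRows (j ∷ js) G G-resp K = begin
      expand (replicate (C j) (typeII j) ++ typeIIRows js) G K
        ≈⟨ expand-++ (replicate (C j) (typeII j)) (typeIIRows js) G K ⟩
      expand (replicate (C j) (typeII j)) (expand (typeIIRows js) G) K
        ≈⟨ expand-typeII (C j) j (expand (typeIIRows js) G) (expand-resp (typeIIRows js) G G-resp) K ⟩
      OrderedChoice.choices (λ a → W a j) H H-resp (C j) (λ a → K a j)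
        ≈⟨ choices-cong (λ a → W a j) H H' H-resp H'-resp (λ T → expand-typeIIRows js G G-resp (updateColumn K j T)) (C j) (λ _ → P.refl) ⟩
      OrderedChoice.choices (λ a → W a j) H' H'-resp (C j) (λ a → K a j)
        ≈⟨ OrderedChoice.choices≈ (λ a → W a j) H' H'-resp (C j) (λ a → K a j) ⟩
      LineChoices.lineByLine C (λ j a → W a j) (j ∷ js) (λ Z → G (transpose Z)) (transpose K) ∎
      where
      H H' : Subset m → Carrier
      H  T = expand (typeIIRows js) G (updateColumn K j T)
      H' T = LineChoices.lineByLine C (λ j a → W a j) js (λ Z → G (transpose Z)) (updateLine (transpose K) j T)
      H-resp : H Preserves _≗_ ⟶ _≈_
      H-resp = updateColumn-resp _ (expand-resp (typeIIRows js) G G-resp) K j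
      H'-resp : H' Preserves _≗_ ⟶ _≈_
      H'-resp = updateLine-resp _ (LineChoices.lineByLine-resp C (λ j a → W a j) js _ (λ e → G-resp λ a b → e b a)) (transpose K) j

  module Assembly (m n : ℕ) (R : Fin m → ℕ) (C : Fin n → ℕ) (W : Fin m → Fin n → Carrier)
                  (sums≡ : sumℕ m R ≡ sumℕ n C) (R<n : ∀ i → R i < n) where
    open RowExpansion m n R C W
    open BlockExpansion m n R C W

    typeISize : Fin m → ℕ
    typeISize i = n ∸ R i

    ∅₂ : Grid m n
    ∅₂ _ _ = false

    module Rows    = LineChoices {p = n} typeISize (λ _ _ → 1#)
    module Columns = LineChoices {p = m} C (λ j a → W a j)

    rowFactorials columnFactorials : ℕ
    rowFactorials    = prodℕ m (λ i → typeISize i !)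
    columnFactorials = prodℕ n (λ j → C j !)

    typeIIExpansion : Grid m n → Carrier
    typeIIExpansion = expand (typeIIRows (allFin n)) (λ _ → 1#)

    columnChoices : Grid m n → Carrier
    columnChoices K = ∑ (allGrids n m) λ T →
      guard (Columns.allLinesᵇ T (transpose K)) (Columns.familyWeight T) 1#

    columnChoices-resp : columnChoices Preserves _≗₂_ ⟶ _≈_
    columnChoices-resp e = Sum.⨀-cong (allGrids n m) λ T → guard-cong
      (P.cong and (map-cong (λ j → sizedDisjointᵇ-cong (C j) (λ a → e a j) (λ _ → P.refl)) (allFin n))) refl refl

    length-rowLabels : length (rowLabels 𝓡 m n R C W) ≡ m ℕ.* n
    length-rowLabels = length-blocks R C typeI typeII sums≡ (λ i → ℕP.<⇒≤ (R<n i))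

    per≈rowChoices : per 𝓡 (m ℕ.* n) (matA 𝓡 m n R C W) ≈ Rows.allAtOnce typeIIExpansion ∅₂
    -- rowLabels unfolds to typeIRows typeISize (allFin m) ++ typeIIRows (allFin n).
    per≈rowChoices = begin
      rectPer N N (matA 𝓡 m n R C W)                 ≈⟨ rectPer-cong N N _ _ matA≈labelMatrix ⟩
      rectPer N N (labelMatrix N labels (λ _ → false)) ≈⟨ rectPer≈expand labels N (λ _ → false) length-rowLabels ⟩
      expand labels (λ _ → 1#) ∅₂                    ≈⟨ expand-++ (typeIRows typeISize (allFin m)) (typeIIRows (allFin n)) _ ∅₂ ⟩
      expand (typeIRows typeISize (allFin m)) typeIIExpansion ∅₂
                                                     ≈⟨ expand-typeIRows typeISize (allFin m) _ typeIIExpansion-resp ∅₂ ⟩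
      Rows.lineByLine (allFin m) typeIIExpansion ∅₂  ≈⟨ lineByLine≈allAtOnce m typeISize _ _ typeIIExpansion-resp ∅₂ ⟩
      Rows.allAtOnce typeIIExpansion ∅₂              ∎
      where
      N = m ℕ.* n
      labels = rowLabels 𝓡 m n R C W
      typeIIExpansion-resp = expand-resp (typeIIRows (allFin n)) (λ _ → 1#) (λ _ → refl)

    typeIIExpansion≈ : ∀ K → typeIIExpansion K ≈ fromℕ 𝓡 columnFactorials * columnChoices K
    typeIIExpansion≈ K = trans (expand-typeIIRows (allFin n) (λ _ → 1#) (λ _ → refl) K)
      (lineByLine≈allAtOnce n C (λ j a → W a j) (λ _ → 1#) (λ _ → refl) (transpose K))

    rowsOKᵇ colsOKᵇ : Grid m n → Bool
    rowsOKᵇ D = and (map (λ i → sumℕ n (λ j → bit 𝓡 m n R C W (D i j)) ≡ᵇ R i) (allFin m))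
    colsOKᵇ D = and (map (λ j → sumℕ m (λ i → bit 𝓡 m n R C W (D i j)) ≡ᵇ C j) (allFin n))

    sum-bit≡∣∣ : ∀ {p} (S : Subset p) → sumℕ p (λ j → bit 𝓡 m n R C W (S j)) ≡ ∣ S ∣
    sum-bit≡∣∣ {p} S = ℕSum.⨀-cong (allFin p) (λ j → bit≡boolToℕ (S j))
      where
      bit≡boolToℕ : ∀ b → bit 𝓡 m n R C W b ≡ boolToℕ b
      bit≡boolToℕ true  = P.refl
      bit≡boolToℕ false = P.refl

    rowTest≡rowsOKᵇ : ∀ D → Rows.allLinesᵇ (λ i → ∁ (D i)) ∅₂ ≡ rowsOKᵇ D
    rowTest≡rowsOKᵇ D = P.cong and (map-cong rowTest (allFin m))
      where
      rowTest : ∀ i → sizedDisjointᵇ (typeISize i) (∅₂ i) (∁ (D i)) ≡ (sumℕ n (λ j → bit 𝓡 m n R C W (D i j)) ≡ᵇ R i)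
      rowTest i = P.trans (sizedDisjointᵇ-∁ (R i) (D i) (ℕP.<⇒≤ (R<n i))) (P.cong (_≡ᵇ R i) (P.sym (sum-bit≡∣∣ (D i))))

    rowWeight≈1 : ∀ S → Rows.familyWeight S ≈ 1#
    rowWeight≈1 S = trans (Prod.⨀-cong (allFin m) (λ a → trans (Prod.⨀-cong (allFin n) (λ y → one (S a y))) (Prod.⨀-ε (allFin n))))
                          (Prod.⨀-ε (allFin m))
      where
      one : ∀ b → (if b then 1# else 1#) ≈ 1#
      one true  = refl
      one false = refl

    columnChoices-∁ : ∀ D → rowsOKᵇ D ≡ true →
      columnChoices (∅₂ ∪₂ (λ i → ∁ (D i))) ≈ (if colsOKᵇ D then weightD 𝓡 m n R C W D else 0#)
    columnChoices-∁ D rowsOK = begin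
      columnChoices K
        ≈⟨ singleTermSum-allFuns (Pointwise _≡_) (allSubsets m) (λ _ _ → P.refl) (singleTermSum-allSubsets m) n
             (transpose D) columnTerm columnTerm-resp vanish ⟩
      columnTerm (transpose D)
        ≈⟨ guard-cong columnsOK (Prod.⨀-comm (allFin n) (allFin m) (λ j a → if D a j then W a j else 1#)) refl ⟩
      guard (colsOKᵇ D) (weightD 𝓡 m n R C W D) 1#
        ≈⟨ *-identityʳ _ ⟩
      (if colsOKᵇ D then weightD 𝓡 m n R C W D else 0#) ∎
      where
      K = ∅₂ ∪₂ (λ i → ∁ (D i))
      columnTerm : Grid n m → Carrier
      columnTerm T = guard (Columns.allLinesᵇ T (transpose K)) (Columns.familyWeight T) 1#
      columnTerm-resp : columnTerm Preserves Pointwise (Pointwise _≡_) ⟶ _≈_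
      columnTerm-resp e = guard-cong
        (P.cong and (map-cong (λ j → sizedDisjointᵇ-cong (C j) (λ _ → P.refl) (e j)) (allFin n)))
        (Prod.⨀-cong (allFin n) (λ j → weight-cong (λ a → W a j) (e j))) refl
      columnsOK : Columns.allLinesᵇ (transpose D) (transpose K) ≡ colsOKᵇ D
      columnsOK = P.cong and (map-cong (λ j → P.trans
        (P.cong₂ _∧_ (P.cong (_≡ᵇ C j) (P.sym (sum-bit≡∣∣ (transpose D j)))) (disjointᵇ-∅∪∁ (transpose D j)))
        (∧-identityʳ _)) (allFin n))
      forced : ∀ T → Columns.allLinesᵇ T (transpose K) ≡ true → T ≗₂ transpose D
      forced T ok = ⊆-transpose-≗ D T C
        (λ j → disjointᵇ-∅∪∁⇒⊆ (T j) (transpose D j) (proj₂ (∧≡true⁻ (and-allFin⁻ _ ok j))))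
        (λ j → ≡ᵇ⇒≡ {∣ T j ∣} (proj₁ (∧≡true⁻ (and-allFin⁻ _ ok j))))
        (P.trans (ℕSum.⨀-cong (allFin m) (λ i → P.trans (P.sym (sum-bit≡∣∣ (D i))) (≡ᵇ⇒≡ {sumℕ n _} (and-allFin⁻ _ rowsOK i))))
                 sums≡)
      vanish : ∀ T → ¬ Pointwise (Pointwise _≡_) T (transpose D) → columnTerm T ≈ 0#
      vanish T T≉D = byCases _ P.refl
        where
        byCases : ∀ b → Columns.allLinesᵇ T (transpose K) ≡ b → columnTerm T ≈ 0#
        byCases true  ok = contradiction (forced T ok) T≉D
        byCases false ok = guard-≡false _ _ ok

    gridTerm : Grid m n → Carrier
    gridTerm S = guard (Rows.allLinesᵇ S ∅₂) (Rows.familyWeight S) (columnChoices (∅₂ ∪₂ S))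

    gridTerm-resp : gridTerm Preserves _≗₂_ ⟶ _≈_
    gridTerm-resp e = guard-cong
      (P.cong and (map-cong (λ a → sizedDisjointᵇ-cong (typeISize a) (λ _ → P.refl) (e a)) (allFin m)))
      (Prod.⨀-cong (allFin m) (λ a → weight-cong (λ _ → 1#) (e a)))
      (columnChoices-resp (λ a b → P.cong (_∨ false) (e a b)))

    gridTerm-∁ : ∀ D → gridTerm (λ i → ∁ (D i)) ≈ (if marginsOK 𝓡 m n R C W D then weightD 𝓡 m n R C W D else 0#)
    gridTerm-∁ D = byCases _ P.refl
      where
      byCases : ∀ b → rowsOKᵇ D ≡ b →
        gridTerm (λ i → ∁ (D i)) ≈ (if marginsOK 𝓡 m n R C W D then weightD 𝓡 m n R C W D else 0#)
      byCases false rowsOK = trans (guard-≡false _ _ (P.trans (rowTest≡rowsOKᵇ D) rowsOK))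
        (reflexive (P.sym (P.cong (λ b → if b ∧ colsOKᵇ D then weightD 𝓡 m n R C W D else 0#) rowsOK)))
      byCases true rowsOK = begin
        _ ≈⟨ guard-cong (P.trans (rowTest≡rowsOKᵇ D) rowsOK) (rowWeight≈1 _) refl ⟩
        1# * columnChoices (∅₂ ∪₂ (λ i → ∁ (D i)))        ≈⟨ *-identityˡ _ ⟩
        columnChoices (∅₂ ∪₂ (λ i → ∁ (D i)))             ≈⟨ columnChoices-∁ D rowsOK ⟩
        (if colsOKᵇ D then weightD 𝓡 m n R C W D else 0#)
          ≡⟨ P.cong (λ b → if b ∧ colsOKᵇ D then weightD 𝓡 m n R C W D else 0#) (P.sym rowsOK) ⟩
        (if marginsOK 𝓡 m n R C W D then weightD 𝓡 m n R C W D else 0#) ∎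

    factorials*SigmaSize≈per :
      fromℕ 𝓡 (rowFactorials ℕ.* columnFactorials) * SigmaSize 𝓡 m n R C W ≈ per 𝓡 (m ℕ.* n) (matA 𝓡 m n R C W)
    factorials*SigmaSize≈per = sym (begin
      per 𝓡 (m ℕ.* n) (matA 𝓡 m n R C W)
        ≈⟨ per≈rowChoices ⟩
      A! * ∑ grids (λ S → guard (Rows.allLinesᵇ S ∅₂) (Rows.familyWeight S) (typeIIExpansion (∅₂ ∪₂ S)))
        ≈⟨ *-congˡ (Sum.⨀-cong grids λ S →
             trans (*-congˡ (typeIIExpansion≈ _)) (guard-*ʳ (Rows.allLinesᵇ S ∅₂) (Rows.familyWeight S) _ _)) ⟩
      A! * ∑ grids (λ S → B! * gridTerm S)
        ≈⟨ *-congˡ (∑-*ˡ grids B! gridTerm) ⟩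
      A! * (B! * ∑ grids gridTerm)
        ≈⟨ *-congˡ (*-congˡ (∑-allGrids-∁ m n gridTerm gridTerm-resp)) ⟩
      A! * (B! * ∑ grids (λ D → gridTerm (λ i → ∁ (D i))))
        ≈⟨ *-congˡ (*-congˡ (Sum.⨀-cong grids gridTerm-∁)) ⟩
      A! * (B! * SigmaSize 𝓡 m n R C W)
        ≈⟨ sym (*-assoc _ _ _) ⟩
      (A! * B!) * SigmaSize 𝓡 m n R C W
        ≈⟨ *-congʳ (sym (fromℕ-* rowFactorials columnFactorials)) ⟩
      fromℕ 𝓡 (rowFactorials ℕ.* columnFactorials) * SigmaSize 𝓡 m n R C W ∎)
      where
      A! = fromℕ 𝓡 rowFactorials
      B! = fromℕ 𝓡 columnFactorials
      grids = allGrids m n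

open import Data.Nat using (_*_)

lemma4p1 : ∀ {c ℓ} (𝓡 : CommutativeRing c ℓ) (m n : ℕ)
    (R : Fin m → ℕ) (C : Fin n → ℕ) (W : Fin m → Fin n → CommutativeRing.Carrier 𝓡) →
    sumℕ m R ≡ sumℕ n C →
    (∀ i → 0 < R i) → (∀ i → R i < n) →
    (∀ j → 0 < C j) → (∀ j → C j < m) →
    CommutativeRing._≈_ 𝓡
      (CommutativeRing._*_ 𝓡
        (fromℕ 𝓡 (prodℕ m (λ i → (n ∸ R i) !) * prodℕ n (λ j → C j !)))
        (SigmaSize 𝓡 m n R C W))
      (per 𝓡 (m * n) (matA 𝓡 m n R C W))
lemma4p1 𝓡 m n R C W sums≡ _ R<n _ _ = Assembly.factorials*SigmaSize≈per 𝓡 m n R C W sums≡ R<n
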